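{- Let $n$ be odd, $q=2^n$, and let $L(X)=\sum_{i=0}^{n-1}a_iX^{2^i}\in\mathbb{F}_q[X]$ be a linearized polynomial with adjoint $\bar{L}(X)=\sum_{i=0}^{n-1}a_i^{2^{n-i}}X^{2^{n-i}}$. Then the set $\{(x,L(x)):x\in\mathbb{F}_q\}\cup\{(0),(\infty)\}$ is a hyperoval in $\Pi(\mathbb{K}_n)$ if and only if the set of lines $$\mathcal{L}_c=\{l_{m,\bar{L}(m)}: m\in\mathbb{F}_q\}\cup\{l_0,l_\infty\},$$ where $l_{m,\bar L(m)}=\{(x,y): y=x\circ m+\bar{L}(m)\}\cup\{(m)\}$, is a line hyperoval in $\Pi(\mathbb{K}_n^{td})$.
   Context: $\mathrm{Tr}:\mathbb{F}_q\to\mathbb{F}_2$ is the absolute trace. Knuth's presemifield $\mathbb{K}_n=(\mathbb{F}_q,+,*)$ ($n$ odd) has $x*y=xy+(y\,\mathrm{Tr}(x)+x\,\mathrm{Tr}(y))^2$; the presemifield $\mathbb{K}_n^{td}=(\mathbb{F}_q,+,\circ)$ has $x\circ y=xy+\mathrm{Tr}(x)\,y^{2^{n-1}}+\mathrm{Tr}(x^2y)$. For a presemifield $(\mathbb{F}_q,+,\star)$, the plane $\Pi$ has affine points $(a,b)$, points at infinity $(a)$, $a\in\mathbb{F}_q\cup\{\infty\}$, and lines: $l_\infty$ (the line at infinity, all points $(a)$); $l_a=\{(a,y):y\in\mathbb{F}_q\}\cup\{(\infty)\}$, $a\in\mathbb{F}_q$; $l_{a,b}=\{(x,y):y=x\star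 a+b\}\cup\{(a)\}$. A hyperoval is a set of $q+2$ points no three collinear; a line hyperoval is a set of $q+2$ lines no three concurrent. -}

module Defs where

open import Level using (_⊔_)
open import Data.Nat as ℕ using (ℕ; zero; suc; _∸_)
open import Data.Fin as Fin using (Fin; toℕ)
open import Data.Maybe using (Maybe; just; nothing)
open import Data.Product using (Σ; ∃; _×_; _,_)
open import Data.Sum using (_⊎_)
open import Data.Empty.Polymorphic using (⊥)
open import Data.Unit.Polymorphic using (⊤)
open import Relation.Nullary using (¬_)
open import Relation.Binary.PropositionalEquality as ≡ using (_≡_)
open import Algebra.Bundles using (CommutativeRing)
open import Function.Bundles using (Inverse)

Odd : ℕ → Set
Odd n = ∃ λ k → n ≡ suc (2 ℕ.* k)

-- F is a finite field with exactly 2^n elements (hence F ≅ F_{2^n} = F_q)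
record IsGF {c ℓ} (F : CommutativeRing c ℓ) (n : ℕ) : Set (c ⊔ ℓ) where
  open CommutativeRing F
  field
    0≉1      : ¬ (0# ≈ 1#)
    inverse  : ∀ x → ¬ (x ≈ 0#) → ∃ λ y → (x * y) ≈ 1#
    card     : Inverse (≡.setoid (Fin (2 ℕ.^ n))) setoid

HasExactly : ∀ {a ℓ s} (A : Set a) (eq : A → A → Set ℓ) (S : A → Set s) (N : ℕ) → Set (a ⊔ ℓ ⊔ s)
HasExactly A eq S N =
  Σ (Fin N → A) λ e →
    (∀ i → S (e i)) ×
    (∀ i j → eq (e i) (e j) → i ≡ j) ×
    (∀ p → S p → ∃ λ i → eq p (e i))

module GF {c ℓ} (F : CommutativeRing c ℓ) (n : ℕ) where
  open CommutativeRing F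

  q : ℕ
  q = 2 ℕ.^ n

  pow : Carrier → ℕ → Carrier
  pow x zero    = 1#
  pow x (suc k) = x * pow x k

  sumFin : ∀ {m} → (Fin m → Carrier) → Carrier
  sumFin {zero}  f = 0#
  sumFin {suc m} f = f Fin.zero + sumFin (λ i → f (Fin.suc i))

  Tr : Carrier → Carrier
  Tr x = sumFin {n} (λ i → pow x (2 ℕ.^ toℕ i))

  -- Knuth's presemifield K_n :  x * y = xy + (y Tr(x) + x Tr(y))^2
  _✶_ : Carrier → Carrier → Carrier
  x ✶ y = x * y + pow (y * Tr x + x * Tr y) 2

  -- the presemifield K_n^{td} :  x ∘ y = xy + Tr(x) y^{2^{n-1}} + Tr(x^2 y)
  _∘_ : Carrier → Carrier → Carrier
  x ∘ y = x * y + Tr x * pow y (2 ℕ.^ (n ∸ 1)) + Tr (pow x 2 * y)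

  Lin : (Fin n → Carrier) → Carrier → Carrier
  Lin a x = sumFin (λ i → a i * pow x (2 ℕ.^ toℕ i))

  Adj : (Fin n → Carrier) → Carrier → Carrier
  Adj a x = sumFin (λ i → pow (a i) (2 ℕ.^ (n ∸ toℕ i)) * pow x (2 ℕ.^ (n ∸ toℕ i)))

  -- points: affine (a,b); at infinity (a), a ∈ F ∪ {∞} (nothing = ∞)
  data Point : Set c where
    aff : Carrier → Carrier → Point
    inf : Maybe Carrier → Point

  -- lines: l_∞, l_a (a ∈ F), l_{a,b}
  data Line : Set c where
    l∞  : Line
    lv  : Carrier → Line
    lab : Carrier → Carrier → Line

  _≈P_ : Point → Point → Set ℓ
  aff a b ≈P aff a' b'          = (a ≈ a') × (b ≈ b')
  inf (just a) ≈P inf (just a') = a ≈ a'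
  inf nothing ≈P inf nothing    = ⊤
  _ ≈P _                        = ⊥

  _≈L_ : Line → Line → Set ℓ
  l∞ ≈L l∞               = ⊤
  lv a ≈L lv a'          = a ≈ a'
  lab a b ≈L lab a' b'   = (a ≈ a') × (b ≈ b')
  _ ≈L _                 = ⊥

  module Plane (_⋆_ : Carrier → Carrier → Carrier) where

    _I_ : Point → Line → Set ℓ
    inf _ I l∞               = ⊤
    aff x y I lv a           = x ≈ a
    inf nothing I lv a       = ⊤
    aff x y I lab a b        = y ≈ ((x ⋆ a) + b)
    inf (just m) I lab a b   = m ≈ a
    _ I _                    = ⊥

    Hyperoval : ∀ {s} → (Point → Set s) → Set (c ⊔ ℓ ⊔ s)
    Hyperoval S =
      HasExactly Point _≈P_ S (q ℕ.+ 2) ×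
      (∀ p₁ p₂ p₃ → S p₁ → S p₂ → S p₃ →
        ¬ (p₁ ≈P p₂) → ¬ (p₁ ≈P p₃) → ¬ (p₂ ≈P p₃) →
        ¬ (∃ λ l → (p₁ I l) × (p₂ I l) × (p₃ I l)))

    LineHyperoval : ∀ {s} → (Line → Set s) → Set (c ⊔ ℓ ⊔ s)
    LineHyperoval S =
      HasExactly Line _≈L_ S (q ℕ.+ 2) ×
      (∀ l₁ l₂ l₃ → S l₁ → S l₂ → S l₃ →
        ¬ (l₁ ≈L l₂) → ¬ (l₁ ≈L l₃) → ¬ (l₂ ≈L l₃) →
        ¬ (∃ λ p → (p I l₁) × (p I l₂) × (p I l₃)))

  GraphSet : (Fin n → Carrier) → Point → Set (c ⊔ ℓ)
  GraphSet a p = (∃ λ x → p ≈P aff x (Lin a x)) ⊎ (p ≈P inf (just 0#)) ⊎ (p ≈P inf nothing)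

  LineSet : (Fin n → Carrier) → Line → Set (c ⊔ ℓ)
  LineSet a l = (∃ λ m → l ≈L lab m (Adj a m)) ⊎ (l ≈L lv 0#) ⊎ (l ≈L l∞)

module Submission where

-- For c ∈ F put f_c(x) = x ✶ c + L(x) and g_c(m) = c ∘ m + L̄(m); both maps are additive.
-- The line l_{c,b} meets the graph of L in the points (x, L(x)) with f_c(x) = b, so the
-- point set is a hyperoval iff f_0 has trivial kernel and every f_c (c ≠ 0) has at most
-- one nonzero root; dually, l_{m,L̄(m)} passes through (c, y) iff g_c(m) = y, so the line
-- set is a line hyperoval iff the same holds for the maps g_c.  The two families are
-- adjoint for the trace form, Tr(m f_c(x)) = Tr(x g_c(m)), and the trace form is
-- nondegenerate (Tr 1 = 1 as n is odd), so counting the pairs (x, m) with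
-- Tr(m f_c(x)) = 0 in two ways gives |ker f_c| = |ker g_c|.

open import Defs
open import Data.Nat using (ℕ)
open import Data.Fin using (Fin)
open import Algebra.Bundles using (CommutativeRing)
open import Function.Bundles using (_⇔_)

open import Level using (lift) renaming (_⊔_ to _⊔ˡ_)
open import Data.Nat as ℕ using (zero; suc; _≤_; s≤s; z≤n)
import Data.Nat.Properties as ℕP
open import Data.Fin as Fin using (toℕ)
import Data.Fin.Properties as FinP
open import Data.Bool using (Bool; true; false; not; if_then_else_)
open import Data.Product using (Σ; ∃; _×_; _,_; proj₁; proj₂)
open import Data.Sum using (_⊎_; inj₁; inj₂)
open import Data.Maybe using (just; nothing)
open import Data.Unit.Polymorphic using (tt)
open import Data.Empty using (⊥; ⊥-elim)
open import Data.Empty.Polymorphic using () renaming (⊥-elim to ⊥ₚ-elim)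
open import Relation.Nullary using (¬_; yes; no; does)
open import Relation.Binary.Definitions using (Decidable)
open import Relation.Binary.PropositionalEquality as ≡ using (_≡_; _≢_)
open import Algebra.Bundles using (CommutativeMonoid)
open import Function.Bundles using (Inverse; Equivalence; mk⇔)
open import Data.Fin.Permutation using (Permutation′; permutation)
import Algebra.Properties.CommutativeMonoid.Sum as CMSum
import Algebra.Properties.Semiring.Sum as SemiringSum
import Algebra.Solver.Ring.NaturalCoefficients.Default as NatSolver

module Σℕ = CMSum ℕP.+-0-commutativeMonoid

module Counting where

  indicator : Bool → ℕ
  indicator true  = 1
  indicator false = 0

  sum-const : ∀ m k → Σℕ.sum {m} (λ _ → k) ≡ m ℕ.* k
  sum-const zero    k = ≡.refl
  sum-const (suc m) k = ≡.cong (k ℕ.+_) (sum-const m k)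

  count : ∀ {m} → (Fin m → Bool) → ℕ
  count P = Σℕ.sum (λ i → indicator (P i))

  count-cong : ∀ {m} {P Q : Fin m → Bool} → (∀ i → P i ≡ Q i) → count P ≡ count Q
  count-cong {m} e = Σℕ.sum-cong-≋ {m} (λ i → ≡.cong indicator (e i))

  count-const-true : ∀ m → count {m} (λ _ → true) ≡ m
  count-const-true zero    = ≡.refl
  count-const-true (suc m) = ≡.cong suc (count-const-true m)

  count-complement : ∀ {m} (P : Fin m → Bool) → count P ℕ.+ count (λ i → not (P i)) ≡ m
  count-complement {zero}  P = ≡.refl
  count-complement {suc m} P with P Fin.zero
  ... | true  = ≡.cong suc (count-complement (λ j → P (Fin.suc j)))
  ... | false = ≡.trans (ℕP.+-suc (count (λ j → P (Fin.suc j))) _)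
                        (≡.cong suc (count-complement (λ j → P (Fin.suc j))))

  remove : ∀ {m} → (Fin m → Bool) → Fin m → Fin m → Bool
  remove P i j = if does (j FinP.≟ i) then false else P j

  count-remove : ∀ {m} (P : Fin m → Bool) i → P i ≡ true → count P ≡ suc (count (remove P i))
  count-remove {suc m} P Fin.zero    e rewrite e = ≡.refl
  count-remove {suc m} P (Fin.suc i) e =
    ≡.trans (≡.cong (indicator (P Fin.zero) ℕ.+_) (count-remove (λ j → P (Fin.suc j)) i e))
            (ℕP.+-suc (indicator (P Fin.zero)) _)

  remove-true⁻ : ∀ {m} (P : Fin m → Bool) i j → remove P i j ≡ true → P j ≡ true × j ≢ i
  remove-true⁻ P i j e with j FinP.≟ i
  remove-true⁻ P i j () | yes _
  ... | no j≢i = e , j≢i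

  remove-true : ∀ {m} (P : Fin m → Bool) i j → P j ≡ true → j ≢ i → remove P i j ≡ true
  remove-true P i j e j≢i with j FinP.≟ i
  ... | yes j≡i = ⊥-elim (j≢i j≡i)
  ... | no _    = e

  1≤count⇒∃ : ∀ {m} (P : Fin m → Bool) → 1 ≤ count P → ∃ λ i → P i ≡ true
  1≤count⇒∃ {zero}  P ()
  1≤count⇒∃ {suc m} P h with P Fin.zero in eq
  ... | true  = Fin.zero , eq
  ... | false = let i , e = 1≤count⇒∃ (λ j → P (Fin.suc j)) h in Fin.suc i , e

  two-distinct⇒2≤count : ∀ {m} (P : Fin m → Bool) i j →
    P i ≡ true → P j ≡ true → j ≢ i → 2 ≤ count P
  two-distinct⇒2≤count P i j ei ej j≢i
    rewrite count-remove P i ei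
          | count-remove (remove P i) j (remove-true P i j ej j≢i) = s≤s (s≤s z≤n)

  three-distinct⇒3≤count : ∀ {m} (P : Fin m → Bool) i j k →
    P i ≡ true → P j ≡ true → P k ≡ true → j ≢ i → k ≢ i → k ≢ j → 3 ≤ count P
  three-distinct⇒3≤count P i j k ei ej ek j≢i k≢i k≢j
    rewrite count-remove P i ei
          | count-remove (remove P i) j (remove-true P i j ej j≢i)
          | count-remove (remove (remove P i) j) k
              (remove-true (remove P i) j k (remove-true P i k ek k≢i) k≢j) = s≤s (s≤s (s≤s z≤n))

  private
    count-remove-≤ : ∀ {m} (P : Fin m → Bool) i → P i ≡ true →
                     ∀ {k} → suc k ≤ count P → k ≤ count (remove P i)
    count-remove-≤ P i e h = ℕP.≤-pred (ℕP.≤-trans h (ℕP.≤-reflexive (count-remove P i e)))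

  2≤count⇒two-distinct : ∀ {m} (P : Fin m → Bool) → 2 ≤ count P →
    ∃ λ i → ∃ λ j → P i ≡ true × P j ≡ true × j ≢ i
  2≤count⇒two-distinct P h =
    let i , ei = 1≤count⇒∃ P (ℕP.≤-trans (s≤s z≤n) h)
        j , ej = 1≤count⇒∃ (remove P i) (count-remove-≤ P i ei h)
        ej′ , j≢i = remove-true⁻ P i j ej
    in i , j , ei , ej′ , j≢i

  3≤count⇒three-distinct : ∀ {m} (P : Fin m → Bool) → 3 ≤ count P →
    ∃ λ i → ∃ λ j → ∃ λ k → P i ≡ true × P j ≡ true × P k ≡ true × j ≢ i × k ≢ i × k ≢ j
  3≤count⇒three-distinct P h =
    let i , ei = 1≤count⇒∃ P (ℕP.≤-trans (s≤s z≤n) h)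
        h₁ = count-remove-≤ P i ei h
        j , ej = 1≤count⇒∃ (remove P i) (ℕP.≤-trans (s≤s z≤n) h₁)
        k , ek = 1≤count⇒∃ (remove (remove P i) j) (count-remove-≤ (remove P i) j ej h₁)
        ek₁ , k≢j = remove-true⁻ (remove P i) j k ek
        ek₂ , k≢i = remove-true⁻ P i k ek₁
        ej₁ , j≢i = remove-true⁻ P i j ej
    in i , j , k , ei , ej₁ , ek₂ , j≢i , k≢i , k≢j

open Counting

two-of-three : ∀ {a r x y} {A : Set a} (R : A → A → Set r) (X : A → Set x) (Y : A → Set y) →
  (∀ {u v} → Y u → Y v → R u v) → ∀ {p₁ p₂ p₃} → X p₁ ⊎ Y p₁ → X p₂ ⊎ Y p₂ → X p₃ ⊎ Y p₃ →
  ¬ R p₁ p₂ → ¬ R p₁ p₃ → ¬ R p₂ p₃ → Σ A λ u → Σ A λ v → X u × X v × ¬ R u v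
two-of-three R X Y Y-related {p₁} {p₂} (inj₁ x₁) (inj₁ x₂) _ n₁₂ _ _ = p₁ , p₂ , x₁ , x₂ , n₁₂
two-of-three R X Y Y-related {p₁} {_} {p₃} (inj₁ x₁) (inj₂ _) (inj₁ x₃) _ n₁₃ _ = p₁ , p₃ , x₁ , x₃ , n₁₃
two-of-three R X Y Y-related (inj₁ _) (inj₂ y₂) (inj₂ y₃) _ _ n₂₃ = ⊥-elim (n₂₃ (Y-related y₂ y₃))
two-of-three R X Y Y-related {_} {p₂} {p₃} (inj₂ _) (inj₁ x₂) (inj₁ x₃) _ _ n₂₃ = p₂ , p₃ , x₂ , x₃ , n₂₃
two-of-three R X Y Y-related (inj₂ y₁) (inj₁ _) (inj₂ y₃) _ n₁₃ _ = ⊥-elim (n₁₃ (Y-related y₁ y₃))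
two-of-three R X Y Y-related (inj₂ y₁) (inj₂ y₂) _ n₁₂ _ _ = ⊥-elim (n₁₂ (Y-related y₁ y₂))

module FiniteField {c ℓ} (F : CommutativeRing c ℓ) (n : ℕ) (gf : IsGF F n) where
  open CommutativeRing F
  open IsGF gf
  open GF F n
  open Inverse card using (to; from; from-cong; inverseˡ; inverseʳ)
  open import Relation.Binary.Reasoning.Setoid setoid
  open NatSolver commutativeSemiring using (solve; _:=_; _:+_; _:*_; con)
  open import Algebra.Properties.Group +-group using () renaming (∙-cancelˡ to +-cancelˡ)

  to-from : ∀ x → to (from x) ≈ x
  to-from x = inverseˡ ≡.refl

  from-to : ∀ i → from (to i) ≡ i
  from-to i = inverseʳ refl

  from-injective : ∀ {x y} → from x ≡ from y → x ≈ y
  from-injective {x} {y} e = trans (sym (to-from x)) (trans (reflexive (≡.cong to e)) (to-from y))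

  to-injective : ∀ {i j} → to i ≈ to j → i ≡ j
  to-injective {i} {j} e = ≡.trans (≡.sym (from-to i)) (≡.trans (from-cong e) (from-to j))

  _≟_ : Decidable _≈_
  x ≟ y with from x FinP.≟ from y
  ... | yes e = yes (from-injective e)
  ... | no ne = no (λ e → ne (from-cong e))

  interchange : ∀ w x y z → (w + x) + (y + z) ≈ (w + y) + (x + z)
  interchange = solve 4 (λ w x y z → ((w :+ x) :+ (y :+ z)) := ((w :+ y) :+ (x :+ z))) refl

  additive⇒0↦0 : (φ : Carrier → Carrier) → (∀ {x y} → x ≈ y → φ x ≈ φ y) →
                 (∀ x y → φ (x + y) ≈ φ x + φ y) → φ 0# ≈ 0#
  additive⇒0↦0 φ φ-cong φ-+ =
    sym (+-cancelˡ (φ 0#) _ _ (trans (+-identityʳ _) (trans (sym (φ-cong (+-identityʳ 0#))) (φ-+ 0# 0#))))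

  inv : ∀ x → x ≉ 0# → Carrier
  inv x x≉0 = proj₁ (inverse x x≉0)

  *-inv : ∀ x (x≉0 : x ≉ 0#) → x * inv x x≉0 ≈ 1#
  *-inv x x≉0 = proj₂ (inverse x x≉0)

  inv-* : ∀ x (x≉0 : x ≉ 0#) y → inv x x≉0 * (x * y) ≈ y
  inv-* x x≉0 y = trans (sym (*-assoc _ _ _))
    (trans (*-congʳ (trans (*-comm _ _) (*-inv x x≉0))) (*-identityˡ y))

  *-inv-* : ∀ x (x≉0 : x ≉ 0#) y → x * (inv x x≉0 * y) ≈ y
  *-inv-* x x≉0 y = trans (sym (*-assoc _ _ _)) (trans (*-congʳ (*-inv x x≉0)) (*-identityˡ y))

  *-nonzero : ∀ {x y} → x ≉ 0# → y ≉ 0# → x * y ≉ 0#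
  *-nonzero {x} {y} x≉0 y≉0 xy≈0 = y≉0 (begin
    y                      ≈⟨ sym (inv-* x x≉0 y) ⟩
    inv x x≉0 * (x * y)    ≈⟨ *-congˡ xy≈0 ⟩
    inv x x≉0 * 0#         ≈⟨ zeroʳ _ ⟩
    0#                     ∎)

  *-cancelʳ : ∀ {a b p} → p ≉ 0# → a * p ≈ b * p → a ≈ b
  *-cancelʳ {a} {b} {p} p≉0 e = begin
    a                       ≈⟨ sym (*-inv-* p p≉0 a) ⟩
    p * (inv p p≉0 * a)     ≈⟨ solve 3 (λ p i a → (p :* (i :* a)) := (a :* p :* i)) refl p (inv p p≉0) a ⟩
    a * p * inv p p≉0       ≈⟨ *-congʳ e ⟩
    b * p * inv p p≉0       ≈⟨ solve 3 (λ p i b → (b :* p :* i) := (p :* (i :* b))) refl p (inv p p≉0) b ⟩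
    p * (inv p p≉0 * b)     ≈⟨ *-inv-* p p≉0 b ⟩
    b                       ∎

  module Reindex (φ ψ : Carrier → Carrier)
                 (φ-cong : ∀ {x y} → x ≈ y → φ x ≈ φ y) (ψ-cong : ∀ {x y} → x ≈ y → ψ x ≈ ψ y)
                 (φψ : ∀ x → φ (ψ x) ≈ x) (ψφ : ∀ x → ψ (φ x) ≈ x) where

    permutationOf : Permutation′ q
    permutationOf = permutation (λ i → from (φ (to i))) (λ i → from (ψ (to i)))
      (λ y → inverseʳ (trans (φ-cong (to-from _)) (φψ (to y))))
      (λ x → inverseʳ (trans (ψ-cong (to-from _)) (ψφ (to x))))

    sum-reindex : ∀ {a ℓ′} (M : CommutativeMonoid a ℓ′) (h : Carrier → CommutativeMonoid.Carrier M) →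
      (∀ {x y} → x ≈ y → CommutativeMonoid._≈_ M (h x) (h y)) →
      CommutativeMonoid._≈_ M (CMSum.sum M {q} (λ i → h (to i))) (CMSum.sum M {q} (λ i → h (φ (to i))))
    sum-reindex M h h-cong =
      M.trans (sum-permute (λ i → h (to i)) permutationOf) (sum-cong-≋ {q} (λ i → h-cong (to-from (φ (to i)))))
      where
      module M = CommutativeMonoid M
      open CMSum M using (sum-permute; sum-cong-≋)

    count-reindex : (P : Carrier → Bool) → (∀ {x y} → x ≈ y → P x ≡ P y) →
                    count {q} (λ i → P (to i)) ≡ count {q} (λ i → P (φ (to i)))
    count-reindex P P-cong =
      sum-reindex ℕP.+-0-commutativeMonoid (λ y → indicator (P y)) (λ e → ≡.cong indicator (P-cong e))

  isZero : Carrier → Bool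
  isZero x = does (x ≟ 0#)

  isZero-cong : ∀ {x y} → x ≈ y → isZero x ≡ isZero y
  isZero-cong {x} {y} e with x ≟ 0# | y ≟ 0#
  ... | yes _  | yes _  = ≡.refl
  ... | no _   | no _   = ≡.refl
  ... | yes x0 | no y≉0 = ⊥-elim (y≉0 (trans (sym e) x0))
  ... | no x≉0 | yes y0 = ⊥-elim (x≉0 (trans e y0))

  isZero≡true⇒≈0 : ∀ {x} → isZero x ≡ true → x ≈ 0#
  isZero≡true⇒≈0 {x} e with x ≟ 0#
  ... | yes x0 = x0
  isZero≡true⇒≈0 () | no _

  ≈0⇒isZero≡true : ∀ {x} → x ≈ 0# → isZero x ≡ true
  ≈0⇒isZero≡true {x} x0 with x ≟ 0#
  ... | yes _   = ≡.refl
  ... | no x≉0 = ⊥-elim (x≉0 x0)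

  ≉0⇒isZero≡false : ∀ {x} → x ≉ 0# → isZero x ≡ false
  ≉0⇒isZero≡false {x} x≉0 with x ≟ 0#
  ... | yes x0 = ⊥-elim (x≉0 x0)
  ... | no _   = ≡.refl

  module S+ = CMSum +-commutativeMonoid
  module S* = CMSum *-commutativeMonoid

  fromℕ : ℕ → Carrier
  fromℕ zero    = 0#
  fromℕ (suc m) = 1# + fromℕ m

  fromℕ-+ : ∀ a b → fromℕ (a ℕ.+ b) ≈ fromℕ a + fromℕ b
  fromℕ-+ zero    b = sym (+-identityˡ _)
  fromℕ-+ (suc a) b = trans (+-congˡ (fromℕ-+ a b)) (sym (+-assoc _ _ _))

  sum-1# : ∀ m → S+.sum {m} (λ _ → 1#) ≈ fromℕ m
  sum-1# zero    = refl
  sum-1# (suc m) = +-congˡ (sum-1# m)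

  pow-cong : ∀ {x y} k → x ≈ y → pow x k ≈ pow y k
  pow-cong zero    e = refl
  pow-cong (suc k) e = *-cong e (pow-cong k e)

  ≡⇒pow≈ : ∀ x {a b} → a ≡ b → pow x a ≈ pow x b
  ≡⇒pow≈ x ≡.refl = refl

  pow-nonzero : ∀ {x} k → x ≉ 0# → pow x k ≉ 0#
  pow-nonzero zero    x≉0 e = 0≉1 (sym e)
  pow-nonzero (suc k) x≉0   = *-nonzero x≉0 (pow-nonzero k x≉0)

  pow-+ : ∀ x a b → pow x (a ℕ.+ b) ≈ pow x a * pow x b
  pow-+ x zero    b = sym (*-identityˡ _)
  pow-+ x (suc a) b = trans (*-congˡ (pow-+ x a b)) (sym (*-assoc _ _ _))

  pow-* : ∀ x a b → pow x (a ℕ.* b) ≈ pow (pow x b) a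
  pow-* x zero    b = refl
  pow-* x (suc a) b = trans (pow-+ x b (a ℕ.* b)) (*-congˡ (pow-* x a b))

  pow-distrib-* : ∀ x y k → pow (x * y) k ≈ pow x k * pow y k
  pow-distrib-* x y zero    = sym (*-identityˡ 1#)
  pow-distrib-* x y (suc k) = trans (*-congˡ (pow-distrib-* x y k))
    (solve 4 (λ x y a b → (x :* y :* (a :* b)) := (x :* a :* (y :* b))) refl x y (pow x k) (pow y k))

  pow-1# : ∀ k → pow 1# k ≈ 1#
  pow-1# zero    = refl
  pow-1# (suc k) = trans (*-identityˡ _) (pow-1# k)

  fromℕ-2^ : ∀ k → fromℕ (2 ℕ.^ k) ≈ pow (1# + 1#) k
  fromℕ-2^ zero    = +-identityʳ 1#
  fromℕ-2^ (suc k) = begin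
    fromℕ (2 ℕ.^ k ℕ.+ (2 ℕ.^ k ℕ.+ 0))
      ≈⟨ trans (fromℕ-+ (2 ℕ.^ k) _) (+-congˡ (fromℕ-+ (2 ℕ.^ k) 0)) ⟩
    fromℕ (2 ℕ.^ k) + (fromℕ (2 ℕ.^ k) + 0#)  ≈⟨ +-cong (fromℕ-2^ k) (+-congʳ (fromℕ-2^ k)) ⟩
    P + (P + 0#)                                ≈⟨ solve 1 (λ P → (P :+ (P :+ con 0)) := ((con 1 :+ con 1) :* P)) refl P ⟩
    (1# + 1#) * P                               ∎
    where P = pow (1# + 1#) k

  -- Translating by 1 permutes F, so the sum of all elements equals itself plus q · 1.
  fromℕ-q≈0 : fromℕ q ≈ 0#
  fromℕ-q≈0 = +-cancelˡ S _ _ (begin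
    S + fromℕ q                         ≈⟨ +-congˡ (sym (sum-1# q)) ⟩
    S + S+.sum {q} (λ _ → 1#)           ≈⟨ sym (S+.∑-distrib-+ (λ i → to i) (λ _ → 1#)) ⟩
    S+.sum {q} (λ i → to i + 1#)        ≈⟨ sym (Reindex.sum-reindex (_+ 1#) (_+ - 1#) +-congʳ +-congʳ
                                              (cancel (-‿inverseʳ 1#)) (cancel (-‿inverseˡ 1#))
                                              +-commutativeMonoid (λ y → y) (λ e → e)) ⟩
    S                                   ≈⟨ sym (+-identityʳ S) ⟩
    S + 0#                              ∎)
    where
    S = S+.sum {q} (λ i → to i)
    cancel : ∀ {u v} → u + v ≈ 0# → ∀ y → y + v + u ≈ y
    cancel {u} {v} uv y = trans (+-assoc _ _ _) (trans (+-congˡ (trans (+-comm v u) uv)) (+-identityʳ y))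

  1+1≈0 : 1# + 1# ≈ 0#
  1+1≈0 with (1# + 1#) ≟ 0#
  ... | yes e = e
  ... | no ne = ⊥-elim (pow-nonzero n ne (trans (sym (fromℕ-2^ n)) fromℕ-q≈0))

  x+x≈0 : ∀ x → x + x ≈ 0#
  x+x≈0 x = begin
    x + x         ≈⟨ solve 1 (λ x → (x :+ x) := (x :* (con 1 :+ con 1))) refl x ⟩
    x * (1# + 1#) ≈⟨ *-congˡ 1+1≈0 ⟩
    x * 0#        ≈⟨ zeroʳ x ⟩
    0#            ∎

  x+y≈0⇒x≈y : ∀ {x y} → x + y ≈ 0# → x ≈ y
  x+y≈0⇒x≈y {x} {y} e = begin
    x             ≈⟨ sym (+-identityʳ x) ⟩
    x + 0#        ≈⟨ +-congˡ (sym (x+x≈0 y)) ⟩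
    x + (y + y)   ≈⟨ sym (+-assoc _ _ _) ⟩
    (x + y) + y   ≈⟨ +-congʳ e ⟩
    0# + y        ≈⟨ +-identityˡ y ⟩
    y             ∎

  ≉⇒x+y≉0 : ∀ {x y} → x ≉ y → x + y ≉ 0#
  ≉⇒x+y≉0 x≉y e = x≉y (x+y≈0⇒x≈y e)

  prod-const : ∀ m x → S*.sum {m} (λ _ → x) ≈ pow x m
  prod-const zero    x = refl
  prod-const (suc m) x = *-congˡ (prod-const m x)

  prod-nonzero : ∀ {m} (f : Fin m → Carrier) → (∀ i → f i ≉ 0#) → S*.sum f ≉ 0#
  prod-nonzero {zero}  f h e = 0≉1 (sym e)
  prod-nonzero {suc m} f h   = *-nonzero (h Fin.zero) (prod-nonzero (λ i → f (Fin.suc i)) (λ i → h (Fin.suc i)))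

  prod-ones : ∀ {m} (f : Fin m → Carrier) → (∀ i → f i ≈ 1#) → S*.sum f ≈ 1#
  prod-ones {zero}  f h = refl
  prod-ones {suc m} f h =
    trans (*-cong (h Fin.zero) (prod-ones (λ i → f (Fin.suc i)) (λ i → h (Fin.suc i)))) (*-identityˡ 1#)

  prod-single : ∀ {m} (f : Fin m → Carrier) k → (∀ j → j ≢ k → f j ≈ 1#) → S*.sum f ≈ f k
  prod-single {suc m} f Fin.zero h =
    trans (*-congˡ (prod-ones (λ i → f (Fin.suc i)) (λ i → h (Fin.suc i) (λ ())))) (*-identityʳ _)
  prod-single {suc m} f (Fin.suc k) h =
    trans (*-congʳ (h Fin.zero (λ ()))) (trans (*-identityˡ _)
      (prod-single (λ i → f (Fin.suc i)) k (λ j j≢k → h (Fin.suc j) (λ e → j≢k (FinP.suc-injective e)))))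

  -- Fermat: y ↦ x y permutes the nonzero elements, whose product is P, so the product
  -- of `factor`, which is x^(q-1), equals 1.
  module Fermat (x : Carrier) (x≉0 : x ≉ 0#) where
    nonzeroOr1 : Carrier → Carrier
    nonzeroOr1 y = if isZero y then 1# else y

    factor : Carrier → Carrier
    factor y = if isZero y then 1# else x

    cofactor : Carrier → Carrier
    cofactor y = if isZero y then x else 1#

    nonzeroOr1-nonzero : ∀ y → nonzeroOr1 y ≉ 0#
    nonzeroOr1-nonzero y with y ≟ 0#
    ... | yes _   = λ e → 0≉1 (sym e)
    ... | no y≉0 = y≉0

    nonzeroOr1-cong : ∀ {u v} → u ≈ v → nonzeroOr1 u ≈ nonzeroOr1 v
    nonzeroOr1-cong {u} {v} e with u ≟ 0# | v ≟ 0#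
    ... | yes _  | yes _  = refl
    ... | no _   | no _   = e
    ... | yes u0 | no v≉0 = ⊥-elim (v≉0 (trans (sym e) u0))
    ... | no u≉0 | yes v0 = ⊥-elim (u≉0 (trans e v0))

    nonzeroOr1-* : ∀ y → nonzeroOr1 (x * y) ≈ factor y * nonzeroOr1 y
    nonzeroOr1-* y with y ≟ 0#
    ... | yes y0  rewrite ≈0⇒isZero≡true (trans (*-congˡ y0) (zeroʳ x)) = sym (*-identityˡ 1#)
    ... | no y≉0 rewrite ≉0⇒isZero≡false (*-nonzero x≉0 y≉0)         = refl

    factor-*-cofactor : ∀ y → factor y * cofactor y ≈ x
    factor-*-cofactor y with y ≟ 0#
    ... | yes _ = *-identityˡ x
    ... | no _  = *-identityʳ x

    P : Carrier
    P = S*.sum {q} (λ i → nonzeroOr1 (to i))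

    prod-factor : S*.sum {q} (λ i → factor (to i)) ≈ 1#
    prod-factor = *-cancelʳ (prod-nonzero (λ i → nonzeroOr1 (to i)) (λ i → nonzeroOr1-nonzero (to i))) (begin
      S*.sum {q} (λ i → factor (to i)) * P
        ≈⟨ sym (S*.∑-distrib-+ (λ i → factor (to i)) (λ i → nonzeroOr1 (to i))) ⟩
      S*.sum {q} (λ i → factor (to i) * nonzeroOr1 (to i))
        ≈⟨ S*.sum-cong-≋ {q} (λ i → sym (nonzeroOr1-* (to i))) ⟩
      S*.sum {q} (λ i → nonzeroOr1 (x * to i))
        ≈⟨ sym (Reindex.sum-reindex (x *_) (inv x x≉0 *_) *-congˡ *-congˡ (*-inv-* x x≉0) (inv-* x x≉0)
                  *-commutativeMonoid nonzeroOr1 nonzeroOr1-cong) ⟩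
      P       ≈⟨ sym (*-identityˡ P) ⟩
      1# * P  ∎)

    prod-cofactor : S*.sum {q} (λ i → cofactor (to i)) ≈ x
    prod-cofactor = trans (prod-single (λ i → cofactor (to i)) (from 0#) others) (at0 (to (from 0#)) (to-from 0#))
      where
      others : ∀ j → j ≢ from 0# → cofactor (to j) ≈ 1#
      others j j≢0 rewrite ≉0⇒isZero≡false {to j} (λ e → j≢0 (≡.trans (≡.sym (from-to j)) (from-cong e))) = refl
      at0 : ∀ y → y ≈ 0# → cofactor y ≈ x
      at0 y y0 rewrite ≈0⇒isZero≡true y0 = refl

    pow-q-nonzero : pow x q ≈ x
    pow-q-nonzero = begin
      pow x q                                                  ≈⟨ sym (prod-const q x) ⟩
      S*.sum {q} (λ _ → x)                                     ≈⟨ S*.sum-cong-≋ {q} (λ i → sym (factor-*-cofactor (to i))) ⟩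
      S*.sum {q} (λ i → factor (to i) * cofactor (to i))       ≈⟨ S*.∑-distrib-+ (λ i → factor (to i)) (λ i → cofactor (to i)) ⟩
      S*.sum {q} (λ i → factor (to i)) * S*.sum {q} (λ i → cofactor (to i)) ≈⟨ *-cong prod-factor prod-cofactor ⟩
      1# * x                                                   ≈⟨ *-identityˡ x ⟩
      x                                                        ∎

  q≡suc : ∃ λ k → q ≡ suc k
  q≡suc = go n
    where
    go : ∀ m → ∃ λ k → 2 ℕ.^ m ≡ suc k
    go zero = 0 , ≡.refl
    go (suc m) with go m
    ... | k , e rewrite e = k ℕ.+ suc (k ℕ.+ 0) , ≡.refl

  pow-q : ∀ x → pow x q ≈ x
  pow-q x with x ≟ 0#
  ... | no x≉0 = Fermat.pow-q-nonzero x x≉0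
  ... | yes x0 = trans (pow-cong q x0) (trans (≡⇒pow≈ 0# (proj₂ q≡suc)) (trans (zeroˡ _) (sym x0)))

  square-+ : ∀ x y → pow (x + y) 2 ≈ pow x 2 + pow y 2
  square-+ x y = begin
    pow (x + y) 2
      ≈⟨ solve 2 (λ x y → ((x :+ y) :* ((x :+ y) :* con 1)) :=
                          ((x :* (x :* con 1) :+ y :* (y :* con 1)) :+ (x :* y :+ x :* y))) refl x y ⟩
    (pow x 2 + pow y 2) + (x * y + x * y) ≈⟨ +-congˡ (x+x≈0 (x * y)) ⟩
    (pow x 2 + pow y 2) + 0#              ≈⟨ +-identityʳ _ ⟩
    pow x 2 + pow y 2                     ∎

  pow-2^suc : ∀ x k → pow x (2 ℕ.^ suc k) ≈ pow (pow x (2 ℕ.^ k)) 2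
  pow-2^suc x k = pow-* x 2 (2 ℕ.^ k)

  pow-2^-+ : ∀ k x y → pow (x + y) (2 ℕ.^ k) ≈ pow x (2 ℕ.^ k) + pow y (2 ℕ.^ k)
  pow-2^-+ zero    x y = trans (*-identityʳ _) (+-cong (sym (*-identityʳ x)) (sym (*-identityʳ y)))
  pow-2^-+ (suc k) x y = begin
    pow (x + y) (2 ℕ.^ suc k)                          ≈⟨ pow-2^suc (x + y) k ⟩
    pow (pow (x + y) (2 ℕ.^ k)) 2                      ≈⟨ pow-cong 2 (pow-2^-+ k x y) ⟩
    pow (pow x (2 ℕ.^ k) + pow y (2 ℕ.^ k)) 2          ≈⟨ square-+ _ _ ⟩
    pow (pow x (2 ℕ.^ k)) 2 + pow (pow y (2 ℕ.^ k)) 2  ≈⟨ sym (+-cong (pow-2^suc x k) (pow-2^suc y k)) ⟩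
    pow x (2 ℕ.^ suc k) + pow y (2 ℕ.^ suc k)          ∎

  pow-2^-2^ : ∀ x a b → pow (pow x (2 ℕ.^ a)) (2 ℕ.^ b) ≈ pow x (2 ℕ.^ (a ℕ.+ b))
  pow-2^-2^ x a b = trans (sym (pow-* x (2 ℕ.^ b) (2 ℕ.^ a)))
    (≡⇒pow≈ x (≡.trans (ℕP.*-comm (2 ℕ.^ b) (2 ℕ.^ a)) (≡.sym (ℕP.^-distribˡ-+-* 2 a b))))

  square-pow-2^ : ∀ x k → pow (pow x (2 ℕ.^ k)) 2 ≈ pow (pow x 2) (2 ℕ.^ k)
  square-pow-2^ x k = trans (sym (pow-* x 2 (2 ℕ.^ k)))
    (trans (≡⇒pow≈ x (ℕP.*-comm 2 (2 ℕ.^ k))) (pow-* x (2 ℕ.^ k) 2))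

  sumFin-cong : ∀ {m} {f g : Fin m → Carrier} → (∀ i → f i ≈ g i) → sumFin f ≈ sumFin g
  sumFin-cong {zero}  h = refl
  sumFin-cong {suc m} h = +-cong (h Fin.zero) (sumFin-cong (λ i → h (Fin.suc i)))

  sumFin-+ : ∀ {m} (f g : Fin m → Carrier) → sumFin (λ i → f i + g i) ≈ sumFin f + sumFin g
  sumFin-+ {zero}  f g = sym (+-identityʳ 0#)
  sumFin-+ {suc m} f g = trans (+-congˡ (sumFin-+ (λ i → f (Fin.suc i)) (λ i → g (Fin.suc i)))) (interchange _ _ _ _)

  sumFin-additive : (φ : Carrier → Carrier) → (∀ {x y} → x ≈ y → φ x ≈ φ y) → (∀ x y → φ (x + y) ≈ φ x + φ y) →
                    ∀ {m} (f : Fin m → Carrier) → φ (sumFin f) ≈ sumFin (λ i → φ (f i))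
  sumFin-additive φ φ-cong φ-+ {zero}  f = additive⇒0↦0 φ φ-cong φ-+
  sumFin-additive φ φ-cong φ-+ {suc m} f = trans (φ-+ _ _) (+-congˡ (sumFin-additive φ φ-cong φ-+ (λ i → f (Fin.suc i))))

  *-distribˡ-sumFin : ∀ {m} x (f : Fin m → Carrier) → x * sumFin f ≈ sumFin (λ i → x * f i)
  *-distribˡ-sumFin x = sumFin-additive (x *_) *-congˡ (distribˡ x)

  sumFin-shift : ∀ m (h : ℕ → Carrier) →
    sumFin {m} (λ i → h (suc (toℕ i))) + h 0 ≈ sumFin {m} (λ i → h (toℕ i)) + h m
  sumFin-shift zero    h = refl
  sumFin-shift (suc m) h = begin
    (h 1 + S₂) + h 0                   ≈⟨ solve 3 (λ a b c → ((a :+ b) :+ c) := (c :+ (b :+ a))) refl (h 1) S₂ (h 0) ⟩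
    h 0 + (S₂ + h 1)                   ≈⟨ +-congˡ (sumFin-shift m (λ k → h (suc k))) ⟩
    h 0 + (S₁ + h (suc m))             ≈⟨ sym (+-assoc _ _ _) ⟩
    (h 0 + S₁) + h (suc m)             ∎
    where
    S₁ = sumFin {m} (λ i → h (suc (toℕ i)))
    S₂ = sumFin {m} (λ i → h (suc (suc (toℕ i))))

  sumFin-1# : ∀ m → sumFin {m} (λ _ → 1#) ≈ fromℕ m
  sumFin-1# zero    = refl
  sumFin-1# (suc m) = +-congˡ (sumFin-1# m)

  Tr-cong : ∀ {x y} → x ≈ y → Tr x ≈ Tr y
  Tr-cong e = sumFin-cong {n} (λ i → pow-cong (2 ℕ.^ toℕ i) e)

  Tr-+ : ∀ x y → Tr (x + y) ≈ Tr x + Tr y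
  Tr-+ x y = trans (sumFin-cong {n} (λ i → pow-2^-+ (toℕ i) x y)) (sumFin-+ {n} _ _)

  Tr-0# : Tr 0# ≈ 0#
  Tr-0# = additive⇒0↦0 Tr Tr-cong Tr-+

  Tr-sumFin : ∀ {m} (f : Fin m → Carrier) → Tr (sumFin f) ≈ sumFin (λ i → Tr (f i))
  Tr-sumFin = sumFin-additive Tr Tr-cong Tr-+

  -- Squaring shifts the n Frobenius powers cyclically, because x^(2^n) = x.
  Tr-square : ∀ x → Tr (pow x 2) ≈ Tr x
  Tr-square x = sym (+-cancelˡ x _ _ (begin
    x + Tr x                                ≈⟨ +-comm _ _ ⟩
    Tr x + x                                ≈⟨ +-congˡ (sym (pow-q x)) ⟩
    sumFin {n} (λ i → h (toℕ i)) + h n      ≈⟨ sym (sumFin-shift n h) ⟩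
    sumFin {n} (λ i → h (suc (toℕ i))) + h 0 ≈⟨ +-cong (sym shifted) (*-identityʳ x) ⟩
    Tr (pow x 2) + x                        ≈⟨ +-comm _ _ ⟩
    x + Tr (pow x 2)                        ∎))
    where
    h : ℕ → Carrier
    h j = pow x (2 ℕ.^ j)
    shifted : Tr (pow x 2) ≈ sumFin {n} (λ i → h (suc (toℕ i)))
    shifted = sumFin-cong {n} (λ i → trans (sym (square-pow-2^ x (toℕ i))) (sym (pow-2^suc x (toℕ i))))

  Tr-pow-2^ : ∀ x k → Tr (pow x (2 ℕ.^ k)) ≈ Tr x
  Tr-pow-2^ x zero    = Tr-cong (*-identityʳ x)
  Tr-pow-2^ x (suc k) = trans (Tr-cong (pow-2^suc x k)) (trans (Tr-square _) (Tr-pow-2^ x k))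

  square-Tr : ∀ x → pow (Tr x) 2 ≈ Tr x
  square-Tr x = trans (sumFin-additive (λ z → pow z 2) (pow-cong 2) square-+ {n} _)
                      (trans (sumFin-cong {n} (λ i → square-pow-2^ x (toℕ i))) (Tr-square x))

  idempotent⇒0⊎1 : ∀ t → pow t 2 ≈ t → t ≈ 0# ⊎ t ≈ 1#
  idempotent⇒0⊎1 t e with t ≟ 0#
  ... | yes t0 = inj₁ t0
  ... | no t≉0 with (t + 1#) ≟ 0#
  ...   | yes t+1≈0 = inj₂ (x+y≈0⇒x≈y t+1≈0)
  ...   | no t+1≉0  = ⊥-elim (*-nonzero t≉0 t+1≉0 (begin
    t * (t + 1#)  ≈⟨ solve 1 (λ t → (t :* (t :+ con 1)) := (t :* (t :* con 1) :+ t)) refl t ⟩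
    pow t 2 + t   ≈⟨ +-congʳ e ⟩
    t + t         ≈⟨ x+x≈0 t ⟩
    0#            ∎))

  Tr≈0⊎Tr≈1 : ∀ x → Tr x ≈ 0# ⊎ Tr x ≈ 1#
  Tr≈0⊎Tr≈1 x = idempotent⇒0⊎1 (Tr x) (square-Tr x)

  Tr-*-bit : ∀ t y → t ≈ 0# ⊎ t ≈ 1# → Tr (t * y) ≈ t * Tr y
  Tr-*-bit t y (inj₁ t0) = trans (Tr-cong (trans (*-congʳ t0) (zeroˡ y)))
                                 (trans Tr-0# (sym (trans (*-congʳ t0) (zeroˡ _))))
  Tr-*-bit t y (inj₂ t1) = trans (Tr-cong (trans (*-congʳ t1) (*-identityˡ y)))
                                 (sym (trans (*-congʳ t1) (*-identityˡ _)))

  ✶-cong : ∀ {x x′ y y′} → x ≈ x′ → y ≈ y′ → (x ✶ y) ≈ (x′ ✶ y′)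
  ✶-cong ex ey = +-cong (*-cong ex ey) (pow-cong 2 (+-cong (*-cong ey (Tr-cong ex)) (*-cong ex (Tr-cong ey))))

  ∘-cong : ∀ {x x′ y y′} → x ≈ x′ → y ≈ y′ → (x ∘ y) ≈ (x′ ∘ y′)
  ∘-cong ex ey = +-cong (+-cong (*-cong ex ey) (*-cong (Tr-cong ex) (pow-cong (2 ℕ.^ (n ℕ.∸ 1)) ey)))
                        (Tr-cong (*-cong (pow-cong 2 ex) ey))

  ✶-+ˡ : ∀ x y c → ((x + y) ✶ c) ≈ (x ✶ c) + (y ✶ c)
  ✶-+ˡ x y c = begin
    (x + y) * c + pow (c * Tr (x + y) + (x + y) * s) 2
      ≈⟨ +-congˡ (pow-cong 2 (trans (+-congʳ (*-congˡ (Tr-+ x y)))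
           (solve 6 (λ c tx ty x y s → (c :* (tx :+ ty) :+ (x :+ y) :* s) := ((c :* tx :+ x :* s) :+ (c :* ty :+ y :* s)))
                  refl c (Tr x) (Tr y) x y s))) ⟩
    (x + y) * c + pow ((c * Tr x + x * s) + (c * Tr y + y * s)) 2
      ≈⟨ +-congˡ (square-+ _ _) ⟩
    (x + y) * c + (pow (c * Tr x + x * s) 2 + pow (c * Tr y + y * s) 2)
      ≈⟨ solve 5 (λ x y c A B → ((x :+ y) :* c :+ (A :+ B)) := ((x :* c :+ A) :+ (y :* c :+ B))) refl x y c _ _ ⟩
    (x ✶ c) + (y ✶ c) ∎
    where s = Tr c

  ∘-+ʳ : ∀ c m m′ → (c ∘ (m + m′)) ≈ (c ∘ m) + (c ∘ m′)
  ∘-+ʳ c m m′ = begin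
    c * (m + m′) + Tr c * pow (m + m′) e + Tr (pow c 2 * (m + m′))
      ≈⟨ +-cong (+-congˡ (*-congˡ (pow-2^-+ (n ℕ.∸ 1) m m′))) (trans (Tr-cong (distribˡ _ _ _)) (Tr-+ _ _)) ⟩
    c * (m + m′) + Tr c * (pow m e + pow m′ e) + (Tr (pow c 2 * m) + Tr (pow c 2 * m′))
      ≈⟨ solve 8 (λ c m m′ s A B T U → (c :* (m :+ m′) :+ s :* (A :+ B) :+ (T :+ U)) :=
                                        ((c :* m :+ s :* A :+ T) :+ (c :* m′ :+ s :* B :+ U)))
               refl c m m′ (Tr c) (pow m e) (pow m′ e) (Tr (pow c 2 * m)) (Tr (pow c 2 * m′)) ⟩
    (c ∘ m) + (c ∘ m′) ∎
    where e = 2 ℕ.^ (n ℕ.∸ 1)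

  ≈P-sym : ∀ {p p′} → p ≈P p′ → p′ ≈P p
  ≈P-sym {aff _ _}      {aff _ _}      (e₁ , e₂) = sym e₁ , sym e₂
  ≈P-sym {inf (just _)} {inf (just _)} e = sym e
  ≈P-sym {inf nothing}  {inf nothing}  _ = tt
  ≈P-sym {aff _ _}      {inf _}        (lift ())
  ≈P-sym {inf (just _)} {aff _ _}      (lift ())
  ≈P-sym {inf (just _)} {inf nothing}  (lift ())
  ≈P-sym {inf nothing}  {aff _ _}      (lift ())
  ≈P-sym {inf nothing}  {inf (just _)} (lift ())

  ≈P-trans : ∀ {p p′ p″} → p ≈P p′ → p′ ≈P p″ → p ≈P p″
  ≈P-trans {aff _ _}      {aff _ _}      {aff _ _}      (e₁ , e₂) (e₃ , e₄) = trans e₁ e₃ , trans e₂ e₄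
  ≈P-trans {inf (just _)} {inf (just _)} {inf (just _)} e e′ = trans e e′
  ≈P-trans {inf nothing}  {inf nothing}  {inf nothing}  _ _ = tt
  ≈P-trans {aff _ _}      {aff _ _}      {inf _}        _ (lift ())
  ≈P-trans {aff _ _}      {inf _}        (lift ()) _
  ≈P-trans {inf (just _)} {inf (just _)} {aff _ _}      _ (lift ())
  ≈P-trans {inf (just _)} {inf (just _)} {inf nothing}  _ (lift ())
  ≈P-trans {inf (just _)} {aff _ _}      (lift ()) _
  ≈P-trans {inf (just _)} {inf nothing}  (lift ()) _
  ≈P-trans {inf nothing}  {inf nothing}  {aff _ _}      _ (lift ())
  ≈P-trans {inf nothing}  {inf nothing}  {inf (just _)} _ (lift ())
  ≈P-trans {inf nothing}  {aff _ _}      (lift ()) _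
  ≈P-trans {inf nothing}  {inf (just _)} (lift ()) _

  ≈L-sym : ∀ {l l′} → l ≈L l′ → l′ ≈L l
  ≈L-sym {l∞}      {l∞}      _ = tt
  ≈L-sym {lv _}    {lv _}    e = sym e
  ≈L-sym {lab _ _} {lab _ _} (e₁ , e₂) = sym e₁ , sym e₂
  ≈L-sym {l∞}      {lv _}    (lift ())
  ≈L-sym {l∞}      {lab _ _} (lift ())
  ≈L-sym {lv _}    {l∞}      (lift ())
  ≈L-sym {lv _}    {lab _ _} (lift ())
  ≈L-sym {lab _ _} {l∞}      (lift ())
  ≈L-sym {lab _ _} {lv _}    (lift ())

  ≈L-trans : ∀ {l l′ l″} → l ≈L l′ → l′ ≈L l″ → l ≈L l″
  ≈L-trans {l∞}      {l∞}      {l∞}      _ _ = tt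
  ≈L-trans {lv _}    {lv _}    {lv _}    e e′ = trans e e′
  ≈L-trans {lab _ _} {lab _ _} {lab _ _} (e₁ , e₂) (e₃ , e₄) = trans e₁ e₃ , trans e₂ e₄
  ≈L-trans {l∞}      {l∞}      {lv _}    _ (lift ())
  ≈L-trans {l∞}      {l∞}      {lab _ _} _ (lift ())
  ≈L-trans {l∞}      {lv _}    (lift ()) _
  ≈L-trans {l∞}      {lab _ _} (lift ()) _
  ≈L-trans {lv _}    {lv _}    {l∞}      _ (lift ())
  ≈L-trans {lv _}    {lv _}    {lab _ _} _ (lift ())
  ≈L-trans {lv _}    {l∞}      (lift ()) _
  ≈L-trans {lv _}    {lab _ _} (lift ()) _
  ≈L-trans {lab _ _} {lab _ _} {l∞}      _ (lift ())
  ≈L-trans {lab _ _} {lab _ _} {lv _}    _ (lift ())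
  ≈L-trans {lab _ _} {l∞}      (lift ()) _
  ≈L-trans {lab _ _} {lv _}    (lift ()) _

  module Incidence (_⋆_ : Carrier → Carrier → Carrier)
                   (⋆-cong : ∀ {x x′ y y′} → x ≈ x′ → y ≈ y′ → (x ⋆ y) ≈ (x′ ⋆ y′)) where
    open Plane _⋆_

    I-resp-≈P : ∀ {p p′ l} → p ≈P p′ → p I l → p′ I l
    I-resp-≈P {aff _ _}      {aff _ _}      {lv _}    (ex , ey) h = trans (sym ex) h
    I-resp-≈P {aff _ _}      {aff _ _}      {lab _ _} (ex , ey) h = trans (sym ey) (trans h (+-congʳ (⋆-cong ex refl)))
    I-resp-≈P {aff _ _}      {aff _ _}      {l∞}      _ (lift ())
    I-resp-≈P {inf (just _)} {inf (just _)} {l∞}      _ _ = tt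
    I-resp-≈P {inf (just _)} {inf (just _)} {lab _ _} e h = trans (sym e) h
    I-resp-≈P {inf (just _)} {inf (just _)} {lv _}    _ (lift ())
    I-resp-≈P {inf nothing}  {inf nothing}  {l∞}      _ _ = tt
    I-resp-≈P {inf nothing}  {inf nothing}  {lv _}    _ _ = tt
    I-resp-≈P {inf nothing}  {inf nothing}  {lab _ _} _ (lift ())
    I-resp-≈P {aff _ _}      {inf _}        (lift ()) _
    I-resp-≈P {inf (just _)} {aff _ _}      (lift ()) _
    I-resp-≈P {inf (just _)} {inf nothing}  (lift ()) _
    I-resp-≈P {inf nothing}  {aff _ _}      (lift ()) _
    I-resp-≈P {inf nothing}  {inf (just _)} (lift ()) _

    I-resp-≈L : ∀ {p l l′} → l ≈L l′ → p I l → p I l′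
    I-resp-≈L {aff _ _}      {lv _}    {lv _}    e h = trans h e
    I-resp-≈L {aff _ _}      {lab _ _} {lab _ _} (e₁ , e₂) h = trans h (+-cong (⋆-cong refl e₁) e₂)
    I-resp-≈L {aff _ _}      {l∞}      {l∞}      _ (lift ())
    I-resp-≈L {inf (just _)} {l∞}      {l∞}      _ _ = tt
    I-resp-≈L {inf (just _)} {lab _ _} {lab _ _} (e₁ , e₂) h = trans h e₁
    I-resp-≈L {inf (just _)} {lv _}    {lv _}    _ (lift ())
    I-resp-≈L {inf nothing}  {l∞}      {l∞}      _ _ = tt
    I-resp-≈L {inf nothing}  {lv _}    {lv _}    _ _ = tt
    I-resp-≈L {inf nothing}  {lab _ _} {lab _ _} _ (lift ())
    I-resp-≈L {_} {l∞}      {lv _}    (lift ()) _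
    I-resp-≈L {_} {l∞}      {lab _ _} (lift ()) _
    I-resp-≈L {_} {lv _}    {l∞}      (lift ()) _
    I-resp-≈L {_} {lv _}    {lab _ _} (lift ()) _
    I-resp-≈L {_} {lab _ _} {l∞}      (lift ()) _
    I-resp-≈L {_} {lab _ _} {lv _}    (lift ()) _

  module ImagePlusTwo {a r} {A : Set a} (R : A → A → Set r)
           (R-sym : ∀ {u v} → R u v → R v u) (R-trans : ∀ {u v w} → R u v → R v w → R u w)
           (embed : Carrier → A) (u v : A)
           (embed-cong : ∀ {x y} → x ≈ y → R (embed x) (embed y))
           (embed-injective : ∀ {x y} → R (embed x) (embed y) → x ≈ y)
           (embed≉u : ∀ {x} → ¬ R (embed x) u) (embed≉v : ∀ {x} → ¬ R (embed x) v)
           (u≉v : ¬ R u v) (u≈u : R u u) (v≈v : R v v) where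

    Member : A → Set (c ⊔ˡ r)
    Member p = (∃ λ x → R p (embed x)) ⊎ R p u ⊎ R p v

    select : Fin q ⊎ Fin 2 → A
    select (inj₁ j)                     = embed (to j)
    select (inj₂ Fin.zero)              = u
    select (inj₂ (Fin.suc Fin.zero))    = v

    select-member : ∀ s → Member (select s)
    select-member (inj₁ j)                  = inj₁ (to j , embed-cong refl)
    select-member (inj₂ Fin.zero)           = inj₂ (inj₁ u≈u)
    select-member (inj₂ (Fin.suc Fin.zero)) = inj₂ (inj₂ v≈v)

    select-injective : ∀ s t → R (select s) (select t) → s ≡ t
    select-injective (inj₁ j) (inj₁ j′) r                                = ≡.cong inj₁ (to-injective (embed-injective r))
    select-injective (inj₁ j) (inj₂ Fin.zero) r                          = ⊥-elim (embed≉u r)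
    select-injective (inj₁ j) (inj₂ (Fin.suc Fin.zero)) r                = ⊥-elim (embed≉v r)
    select-injective (inj₂ Fin.zero) (inj₁ j) r                          = ⊥-elim (embed≉u (R-sym r))
    select-injective (inj₂ Fin.zero) (inj₂ Fin.zero) r                   = ≡.refl
    select-injective (inj₂ Fin.zero) (inj₂ (Fin.suc Fin.zero)) r         = ⊥-elim (u≉v r)
    select-injective (inj₂ (Fin.suc Fin.zero)) (inj₁ j) r                = ⊥-elim (embed≉v (R-sym r))
    select-injective (inj₂ (Fin.suc Fin.zero)) (inj₂ Fin.zero) r         = ⊥-elim (u≉v (R-sym r))
    select-injective (inj₂ (Fin.suc Fin.zero)) (inj₂ (Fin.suc Fin.zero)) r = ≡.refl

    hasExactly : HasExactly A R Member (q ℕ.+ 2)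
    hasExactly = (λ i → select (Fin.splitAt q i)) , (λ i → select-member (Fin.splitAt q i)) , injective , surjective
      where
      injective : ∀ i j → R (select (Fin.splitAt q i)) (select (Fin.splitAt q j)) → i ≡ j
      injective i j r = ≡.trans (≡.sym (FinP.join-splitAt q 2 i))
        (≡.trans (≡.cong (Fin.join q 2) (select-injective (Fin.splitAt q i) (Fin.splitAt q j) r)) (FinP.join-splitAt q 2 j))
      at : ∀ {p} s i → Fin.splitAt q i ≡ s → R p (select s) → ∃ λ i → R p (select (Fin.splitAt q i))
      at s i e r = i , ≡.subst (λ s → R _ (select s)) (≡.sym e) r
      surjective : ∀ p → Member p → ∃ λ i → R p (select (Fin.splitAt q i))
      surjective p (inj₁ (x , r))  = at (inj₁ (from x)) (from x Fin.↑ˡ 2) (FinP.splitAt-↑ˡ q (from x) 2)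
                                        (R-trans r (embed-cong (sym (to-from x))))
      surjective p (inj₂ (inj₁ r)) = at (inj₂ Fin.zero) (q Fin.↑ʳ Fin.zero) (FinP.splitAt-↑ʳ q 2 Fin.zero) r
      surjective p (inj₂ (inj₂ r)) = at (inj₂ (Fin.suc Fin.zero)) (q Fin.↑ʳ Fin.suc Fin.zero)
                                        (FinP.splitAt-↑ʳ q 2 (Fin.suc Fin.zero)) r

  NoNonzeroRoot : (Carrier → Carrier) → Set (c ⊔ˡ ℓ)
  NoNonzeroRoot f = ∀ x → f x ≈ 0# → x ≈ 0#

  AtMostOneNonzeroRoot : (Carrier → Carrier) → Set (c ⊔ˡ ℓ)
  AtMostOneNonzeroRoot f = ∀ x y → f x ≈ 0# → f y ≈ 0# → x ≉ 0# → y ≉ 0# → x ≉ y → ⊥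

  RootCondition : (Carrier → Carrier → Carrier) → Set (c ⊔ˡ ℓ)
  RootCondition h = NoNonzeroRoot (h 0#) × (∀ c → c ≉ 0# → AtMostOneNonzeroRoot (h c))

  additive-root-difference : (f : Carrier → Carrier) → (∀ x y → f (x + y) ≈ f x + f y) →
                             ∀ {x y b} → f x ≈ b → f y ≈ b → f (x + y) ≈ 0#
  additive-root-difference f f-+ {x} {y} {b} ex ey = trans (f-+ x y) (trans (+-cong ex ey) (x+x≈0 b))

  ≈P-common : ∀ t {u v} → u ≈P t → v ≈P t → u ≈P v
  ≈P-common t {u} {v} e e′ = ≈P-trans {u} {t} {v} e (≈P-sym {v} {t} e′)

  ≈L-common : ∀ t {u v} → u ≈L t → v ≈L t → u ≈L v
  ≈L-common t {u} {v} e e′ = ≈L-trans {u} {t} {v} e (≈L-sym {v} {t} e′)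

  module Linearized (a : Fin n → Carrier) where

    Lin-cong : ∀ {x y} → x ≈ y → Lin a x ≈ Lin a y
    Lin-cong e = sumFin-cong {n} (λ i → *-congˡ (pow-cong (2 ℕ.^ toℕ i) e))

    Adj-cong : ∀ {x y} → x ≈ y → Adj a x ≈ Adj a y
    Adj-cong e = sumFin-cong {n} (λ i → *-congˡ (pow-cong (2 ℕ.^ (n ℕ.∸ toℕ i)) e))

    Lin-+ : ∀ x y → Lin a (x + y) ≈ Lin a x + Lin a y
    Lin-+ x y = trans (sumFin-cong {n} (λ i → trans (*-congˡ (pow-2^-+ (toℕ i) x y)) (distribˡ _ _ _))) (sumFin-+ {n} _ _)

    Adj-+ : ∀ x y → Adj a (x + y) ≈ Adj a x + Adj a y
    Adj-+ x y = trans (sumFin-cong {n} (λ i → trans (*-congˡ (pow-2^-+ (n ℕ.∸ toℕ i) x y)) (distribˡ _ _ _))) (sumFin-+ {n} _ _)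

    -- Raise to the power 2^i, which preserves the trace; then m^(2^(n-i) 2^i) = m^q = m.
    Tr-*-monomial : ∀ m x (i : Fin n) →
      Tr (m * (a i * pow x (2 ℕ.^ toℕ i))) ≈ Tr (x * (pow (a i) (2 ℕ.^ (n ℕ.∸ toℕ i)) * pow m (2 ℕ.^ (n ℕ.∸ toℕ i))))
    Tr-*-monomial m x i = sym (begin
      Tr (x * (pow A e * pow m e))            ≈⟨ Tr-cong (*-congˡ (sym (pow-distrib-* A m e))) ⟩
      Tr (x * pow (A * m) e)                  ≈⟨ sym (Tr-pow-2^ _ (toℕ i)) ⟩
      Tr (pow (x * pow (A * m) e) (2 ℕ.^ toℕ i))
        ≈⟨ Tr-cong (pow-distrib-* x (pow (A * m) e) (2 ℕ.^ toℕ i)) ⟩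
      Tr (X * pow (pow (A * m) e) (2 ℕ.^ toℕ i))
        ≈⟨ Tr-cong (*-congˡ (pow-2^-2^ _ (n ℕ.∸ toℕ i) (toℕ i))) ⟩
      Tr (X * pow (A * m) (2 ℕ.^ ((n ℕ.∸ toℕ i) ℕ.+ toℕ i)))
        ≈⟨ Tr-cong (*-congˡ (≡⇒pow≈ _ (≡.cong (2 ℕ.^_) (ℕP.m∸n+n≡m (ℕP.<⇒≤ (FinP.toℕ<n i)))))) ⟩
      Tr (X * pow (A * m) q)                  ≈⟨ Tr-cong (*-congˡ (pow-q _)) ⟩
      Tr (X * (A * m))                        ≈⟨ Tr-cong (solve 3 (λ X A m → (X :* (A :* m)) := (m :* (A :* X))) refl X A m) ⟩
      Tr (m * (A * X))                        ∎)
      where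
      A = a i
      e = 2 ℕ.^ (n ℕ.∸ toℕ i)
      X = pow x (2 ℕ.^ toℕ i)

    Tr-*-Lin : ∀ m x → Tr (m * Lin a x) ≈ Tr (x * Adj a m)
    Tr-*-Lin m x = begin
      Tr (m * Lin a x)                                   ≈⟨ Tr-cong (*-distribˡ-sumFin {n} m _) ⟩
      Tr (sumFin {n} (λ i → m * (a i * pow x (2 ℕ.^ toℕ i)))) ≈⟨ Tr-sumFin {n} _ ⟩
      sumFin {n} (λ i → Tr (m * (a i * pow x (2 ℕ.^ toℕ i)))) ≈⟨ sumFin-cong {n} (Tr-*-monomial m x) ⟩
      sumFin {n} (λ i → Tr (x * adj i))                      ≈⟨ sym (Tr-sumFin {n} _) ⟩
      Tr (sumFin {n} (λ i → x * adj i))                      ≈⟨ Tr-cong (sym (*-distribˡ-sumFin {n} x _)) ⟩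
      Tr (x * Adj a m)                                   ∎
      where
      adj : Fin n → Carrier
      adj i = pow (a i) (2 ℕ.^ (n ℕ.∸ toℕ i)) * pow m (2 ℕ.^ (n ℕ.∸ toℕ i))

    f⟨_⟩ : Carrier → Carrier → Carrier
    f⟨ c ⟩ x = (x ✶ c) + Lin a x

    g⟨_⟩ : Carrier → Carrier → Carrier
    g⟨ c ⟩ m = (c ∘ m) + Adj a m

    f-cong : ∀ c {x y} → x ≈ y → f⟨ c ⟩ x ≈ f⟨ c ⟩ y
    f-cong c e = +-cong (✶-cong e refl) (Lin-cong e)

    g-cong : ∀ c {x y} → x ≈ y → g⟨ c ⟩ x ≈ g⟨ c ⟩ y
    g-cong c e = +-cong (∘-cong refl e) (Adj-cong e)

    f-resp-≈ : ∀ {c c′} → c ≈ c′ → ∀ x → f⟨ c ⟩ x ≈ f⟨ c′ ⟩ x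
    f-resp-≈ e x = +-congʳ (✶-cong refl e)

    g-resp-≈ : ∀ {c c′} → c ≈ c′ → ∀ m → g⟨ c ⟩ m ≈ g⟨ c′ ⟩ m
    g-resp-≈ e m = +-congʳ (∘-cong e refl)

    f-+ : ∀ c x y → f⟨ c ⟩ (x + y) ≈ f⟨ c ⟩ x + f⟨ c ⟩ y
    f-+ c x y = trans (+-cong (✶-+ˡ x y c) (Lin-+ x y)) (interchange _ _ _ _)

    g-+ : ∀ c x y → g⟨ c ⟩ (x + y) ≈ g⟨ c ⟩ x + g⟨ c ⟩ y
    g-+ c x y = trans (+-cong (∘-+ʳ c x y) (Adj-+ x y)) (interchange _ _ _ _)

    f-0# : ∀ c → f⟨ c ⟩ 0# ≈ 0#
    f-0# c = additive⇒0↦0 f⟨ c ⟩ (f-cong c) (f-+ c)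

    g-0# : ∀ c → g⟨ c ⟩ 0# ≈ 0#
    g-0# c = additive⇒0↦0 g⟨ c ⟩ (g-cong c) (g-+ c)

    module Π✶ = Plane _✶_
    module Π∘ = Plane _∘_
    module I✶ = Incidence _✶_ ✶-cong
    module I∘ = Incidence _∘_ ∘-cong

    graphPoint : Carrier → Point
    graphPoint x = aff x (Lin a x)

    setLine : Carrier → Line
    setLine m = lab m (Adj a m)

    graph-hasExactly : HasExactly Point _≈P_ (GraphSet a) (q ℕ.+ 2)
    graph-hasExactly = ImagePlusTwo.hasExactly _≈P_ (λ {u} {v} → ≈P-sym {u} {v}) (λ {u} {v} {w} → ≈P-trans {u} {v} {w})
      graphPoint (inf (just 0#)) (inf nothing)
      (λ e → e , Lin-cong e) proj₁ (λ { (lift ()) }) (λ { (lift ()) }) (λ { (lift ()) }) refl tt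

    lineSet-hasExactly : HasExactly Line _≈L_ (LineSet a) (q ℕ.+ 2)
    lineSet-hasExactly = ImagePlusTwo.hasExactly _≈L_ (λ {u} {v} → ≈L-sym {u} {v}) (λ {u} {v} {w} → ≈L-trans {u} {v} {w})
      setLine (lv 0#) l∞
      (λ e → e , Adj-cong e) proj₁ (λ { (lift ()) }) (λ { (lift ()) }) (λ { (lift ()) }) refl tt

    NoThreeCollinear : Set (c ⊔ˡ ℓ)
    NoThreeCollinear = ∀ p₁ p₂ p₃ → GraphSet a p₁ → GraphSet a p₂ → GraphSet a p₃ →
      ¬ (p₁ ≈P p₂) → ¬ (p₁ ≈P p₃) → ¬ (p₂ ≈P p₃) → ¬ (∃ λ l → (p₁ Π✶.I l) × (p₂ Π✶.I l) × (p₃ Π✶.I l))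

    NoThreeConcurrent : Set (c ⊔ˡ ℓ)
    NoThreeConcurrent = ∀ l₁ l₂ l₃ → LineSet a l₁ → LineSet a l₂ → LineSet a l₃ →
      ¬ (l₁ ≈L l₂) → ¬ (l₁ ≈L l₃) → ¬ (l₂ ≈L l₃) → ¬ (∃ λ p → (p Π∘.I l₁) × (p Π∘.I l₂) × (p Π∘.I l₃))

    ≉⇒¬≈aff : ∀ {x y} → x ≉ y → ¬ (graphPoint x ≈P graphPoint y)
    ≉⇒¬≈aff x≉y e = x≉y (proj₁ e)

    ≉⇒¬≈lab : ∀ {x y} → x ≉ y → ¬ (setLine x ≈L setLine y)
    ≉⇒¬≈lab x≉y e = x≉y (proj₁ e)

    root⇒on-line : ∀ {c x} → f⟨ c ⟩ x ≈ 0# → graphPoint x Π✶.I lab c 0#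
    root⇒on-line e = trans (sym (x+y≈0⇒x≈y e)) (sym (+-identityʳ _))

    -- A nonzero root x of f_c puts (x, L x) on the line l_{c,0}, which also contains
    -- (0, L 0) and, for c = 0, the point (0).
    noThreeCollinear⇒rootCondition : NoThreeCollinear → RootCondition f⟨_⟩
    noThreeCollinear⇒rootCondition N = root₀ , roots
      where
      member : ∀ x → GraphSet a (graphPoint x)
      member x = inj₁ (x , refl , refl)
      root₀ : NoNonzeroRoot f⟨ 0# ⟩
      root₀ x fx with x ≟ 0#
      ... | yes x0  = x0
      ... | no x≉0 = ⊥-elim (N (graphPoint 0#) (graphPoint x) (inf (just 0#)) (member 0#) (member x)
        (inj₂ (inj₁ refl)) (≉⇒¬≈aff (λ e → x≉0 (sym e))) (λ { (lift ()) }) (λ { (lift ()) })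
        (lab 0# 0# , root⇒on-line (f-0# 0#) , root⇒on-line fx , refl))
      roots : ∀ c → c ≉ 0# → AtMostOneNonzeroRoot f⟨ c ⟩
      roots c _ x y fx fy x≉0 y≉0 x≉y = N (graphPoint 0#) (graphPoint x) (graphPoint y) (member 0#) (member x) (member y)
        (≉⇒¬≈aff (λ e → x≉0 (sym e))) (≉⇒¬≈aff (λ e → y≉0 (sym e))) (≉⇒¬≈aff x≉y)
        (lab c 0# , root⇒on-line (f-0# c) , root⇒on-line fx , root⇒on-line fy)

    -- Dually, a nonzero root m of g_c puts l_{m,L̄ m} through (c, 0), as are l_{0,L̄ 0}
    -- and, for c = 0, the line l_0.
    noThreeConcurrent⇒rootCondition : NoThreeConcurrent → RootCondition g⟨_⟩
    noThreeConcurrent⇒rootCondition N = root₀ , roots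
      where
      member : ∀ m → LineSet a (setLine m)
      member m = inj₁ (m , refl , refl)
      root₀ : NoNonzeroRoot g⟨ 0# ⟩
      root₀ m gm with m ≟ 0#
      ... | yes m0  = m0
      ... | no m≉0 = ⊥-elim (N (setLine 0#) (setLine m) (lv 0#) (member 0#) (member m) (inj₂ (inj₁ refl))
        (≉⇒¬≈lab (λ e → m≉0 (sym e))) (λ { (lift ()) }) (λ { (lift ()) })
        (aff 0# 0# , sym (g-0# 0#) , sym gm , refl))
      roots : ∀ c → c ≉ 0# → AtMostOneNonzeroRoot g⟨ c ⟩
      roots c _ x y gx gy x≉0 y≉0 x≉y = N (setLine 0#) (setLine x) (setLine y) (member 0#) (member x) (member y)
        (≉⇒¬≈lab (λ e → x≉0 (sym e))) (≉⇒¬≈lab (λ e → y≉0 (sym e))) (≉⇒¬≈lab x≉y)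
        (aff c 0# , sym (g-0# c) , sym gx , sym gy)

    GraphPointOn : Carrier → Carrier → Point → Set (c ⊔ˡ ℓ)
    GraphPointOn c b p = ∃ λ x → p ≈P graphPoint x × f⟨ c ⟩ x ≈ b

    on-line⇒f≈ : ∀ {c b x} → graphPoint x Π✶.I lab c b → f⟨ c ⟩ x ≈ b
    on-line⇒f≈ {c} {b} {x} e = begin
      (x ✶ c) + Lin a x         ≈⟨ +-congˡ e ⟩
      (x ✶ c) + ((x ✶ c) + b)   ≈⟨ sym (+-assoc _ _ _) ⟩
      ((x ✶ c) + (x ✶ c)) + b   ≈⟨ +-congʳ (x+x≈0 _) ⟩
      0# + b                    ≈⟨ +-identityˡ b ⟩
      b                         ∎

    graph∩l∞ : ∀ {p} → GraphSet a p → p Π✶.I l∞ → p ≈P inf (just 0#) ⊎ p ≈P inf nothing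
    graph∩l∞ {p} (inj₁ (x , e)) h = ⊥ₚ-elim (I✶.I-resp-≈P {p} {graphPoint x} {l∞} e h)
    graph∩l∞     (inj₂ s)       h = s

    graph∩lv : ∀ {p c} → GraphSet a p → p Π✶.I lv c → p ≈P graphPoint c ⊎ p ≈P inf nothing
    graph∩lv {p} {c} (inj₁ (x , e)) h = inj₁ (≈P-trans {p} {graphPoint x} {graphPoint c} e (x≈c , Lin-cong x≈c))
      where x≈c = I✶.I-resp-≈P {p} {graphPoint x} {lv c} e h
    graph∩lv {p} {c} (inj₂ (inj₁ e)) h = ⊥ₚ-elim (I✶.I-resp-≈P {p} {inf (just 0#)} {lv c} e h)
    graph∩lv         (inj₂ (inj₂ e)) h = inj₂ e

    graph∩lab : ∀ {p c b} → GraphSet a p → p Π✶.I lab c b → GraphPointOn c b p ⊎ (p ≈P inf (just 0#) × 0# ≈ c)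
    graph∩lab {p} {c} {b} (inj₁ (x , e))  h = inj₁ (x , e , on-line⇒f≈ (I✶.I-resp-≈P {p} {graphPoint x} {lab c b} e h))
    graph∩lab {p} {c} {b} (inj₂ (inj₁ e)) h = inj₂ (e , I✶.I-resp-≈P {p} {inf (just 0#)} {lab c b} e h)
    graph∩lab {p} {c} {b} (inj₂ (inj₂ e)) h = ⊥ₚ-elim (I✶.I-resp-≈P {p} {inf nothing} {lab c b} e h)

    graph∩lab-c≉0 : ∀ {p c b} → c ≉ 0# → GraphPointOn c b p ⊎ (p ≈P inf (just 0#) × 0# ≈ c) → GraphPointOn c b p
    graph∩lab-c≉0 c≉0 (inj₁ on)     = on
    graph∩lab-c≉0 c≉0 (inj₂ (_ , e)) = ⊥-elim (c≉0 (sym e))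

    GraphPointOn-≉ : ∀ {c b u v} (on-u : GraphPointOn c b u) (on-v : GraphPointOn c b v) →
                     ¬ (u ≈P v) → proj₁ on-u ≉ proj₁ on-v
    GraphPointOn-≉ {u = u} {v} (x , eu , _) (y , ev , _) u≉v x≈y =
      u≉v (≈P-trans {u} {graphPoint x} {v} eu (≈P-common (graphPoint y) {graphPoint x} {v} (x≈y , Lin-cong x≈y) ev))

    two-on-line⇒root : ∀ {c b u v} (on-u : GraphPointOn c b u) (on-v : GraphPointOn c b v) → ¬ (u ≈P v) →
      f⟨ c ⟩ (proj₁ on-u + proj₁ on-v) ≈ 0# × proj₁ on-u + proj₁ on-v ≉ 0#
    two-on-line⇒root {c} {u = u} {v} on-u@(_ , _ , fx) on-v@(_ , _ , fy) u≉v =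
      additive-root-difference f⟨ c ⟩ (f-+ c) fx fy , ≉⇒x+y≉0 (GraphPointOn-≉ {u = u} {v} on-u on-v u≉v)

    rootCondition⇒noThreeCollinear : RootCondition f⟨_⟩ → NoThreeCollinear
    rootCondition⇒noThreeCollinear _ p₁ p₂ p₃ s₁ s₂ s₃ n₁₂ n₁₃ n₂₃ (l∞ , h₁ , h₂ , h₃) =
      let u , v , u∞ , v∞ , u≉v = two-of-three _≈P_ (_≈P inf (just 0#)) (_≈P inf nothing)
            (λ {u} {v} → ≈P-common (inf nothing) {u} {v}) {p₁} {p₂} {p₃}
            (graph∩l∞ {p₁} s₁ h₁) (graph∩l∞ {p₂} s₂ h₂) (graph∩l∞ {p₃} s₃ h₃) n₁₂ n₁₃ n₂₃
      in u≉v (≈P-common (inf (just 0#)) {u} {v} u∞ v∞)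
    rootCondition⇒noThreeCollinear _ p₁ p₂ p₃ s₁ s₂ s₃ n₁₂ n₁₃ n₂₃ (lv c , h₁ , h₂ , h₃) =
      let u , v , uc , vc , u≉v = two-of-three _≈P_ (_≈P graphPoint c) (_≈P inf nothing)
            (λ {u} {v} → ≈P-common (inf nothing) {u} {v}) {p₁} {p₂} {p₃}
            (graph∩lv {p₁} s₁ h₁) (graph∩lv {p₂} s₂ h₂) (graph∩lv {p₃} s₃ h₃) n₁₂ n₁₃ n₂₃
      in u≉v (≈P-common (graphPoint c) {u} {v} uc vc)
    rootCondition⇒noThreeCollinear (root₀ , roots) p₁ p₂ p₃ s₁ s₂ s₃ n₁₂ n₁₃ n₂₃ (lab c b , h₁ , h₂ , h₃)
      with c ≟ 0#
    ... | yes c0 =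
      let u , v , on-u , on-v , u≉v = two-of-three _≈P_ (GraphPointOn c b) (λ p → p ≈P inf (just 0#) × 0# ≈ c)
            (λ {u} {v} eu ev → ≈P-common (inf (just 0#)) {u} {v} (proj₁ eu) (proj₁ ev)) {p₁} {p₂} {p₃}
            (graph∩lab {p₁} s₁ h₁) (graph∩lab {p₂} s₂ h₂) (graph∩lab {p₃} s₃ h₃) n₁₂ n₁₃ n₂₃
          root , nonzero = two-on-line⇒root {c} {b} {u} {v} on-u on-v u≉v
      in nonzero (root₀ _ (trans (f-resp-≈ (sym c0) _) root))
    ... | no c≉0 =
      let on₁ = graph∩lab-c≉0 {p₁} {c} {b} c≉0 (graph∩lab {p₁} s₁ h₁)
          on₂ = graph∩lab-c≉0 {p₂} {c} {b} c≉0 (graph∩lab {p₂} s₂ h₂)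
          on₃ = graph∩lab-c≉0 {p₃} {c} {b} c≉0 (graph∩lab {p₃} s₃ h₃)
          root₁₂ , nonzero₁₂ = two-on-line⇒root {c} {b} {p₁} {p₂} on₁ on₂ n₁₂
          root₁₃ , nonzero₁₃ = two-on-line⇒root {c} {b} {p₁} {p₃} on₁ on₃ n₁₃
      in roots c c≉0 _ _ root₁₂ root₁₃ nonzero₁₂ nonzero₁₃
           (λ e → GraphPointOn-≉ {c} {b} {p₂} {p₃} on₂ on₃ n₂₃ (+-cancelˡ (proj₁ on₁) _ _ e))

    SetLineThrough : Carrier → Carrier → Line → Set (c ⊔ˡ ℓ)
    SetLineThrough x y l = ∃ λ m → l ≈L setLine m × g⟨ x ⟩ m ≈ y

    SetLineThrough∞ : Carrier → Line → Set (c ⊔ˡ ℓ)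
    SetLineThrough∞ m₀ l = ∃ λ m → l ≈L setLine m × m₀ ≈ m

    lineSet∋aff : ∀ {l x y} → LineSet a l → aff x y Π∘.I l → SetLineThrough x y l ⊎ (l ≈L lv 0# × x ≈ 0#)
    lineSet∋aff {l} {x} {y} (inj₁ (m , e))  h = inj₁ (m , e , sym (I∘.I-resp-≈L {aff x y} {l} {setLine m} e h))
    lineSet∋aff {l} {x} {y} (inj₂ (inj₁ e)) h = inj₂ (e , I∘.I-resp-≈L {aff x y} {l} {lv 0#} e h)
    lineSet∋aff {l} {x} {y} (inj₂ (inj₂ e)) h = ⊥ₚ-elim (I∘.I-resp-≈L {aff x y} {l} {l∞} e h)

    lineSet∋inf : ∀ {l m₀} → LineSet a l → inf (just m₀) Π∘.I l → SetLineThrough∞ m₀ l ⊎ l ≈L l∞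
    lineSet∋inf {l} {m₀} (inj₁ (m , e))  h = inj₁ (m , e , I∘.I-resp-≈L {inf (just m₀)} {l} {setLine m} e h)
    lineSet∋inf {l} {m₀} (inj₂ (inj₁ e)) h = ⊥ₚ-elim (I∘.I-resp-≈L {inf (just m₀)} {l} {lv 0#} e h)
    lineSet∋inf          (inj₂ (inj₂ e)) h = inj₂ e

    lineSet∋∞ : ∀ {l} → LineSet a l → inf nothing Π∘.I l → l ≈L lv 0# ⊎ l ≈L l∞
    lineSet∋∞ {l} (inj₁ (m , e)) h = ⊥ₚ-elim (I∘.I-resp-≈L {inf nothing} {l} {setLine m} e h)
    lineSet∋∞     (inj₂ s)       h = s

    lineSet∋aff-x≉0 : ∀ {l x y} → x ≉ 0# → SetLineThrough x y l ⊎ (l ≈L lv 0# × x ≈ 0#) → SetLineThrough x y l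
    lineSet∋aff-x≉0 x≉0 (inj₁ on)     = on
    lineSet∋aff-x≉0 x≉0 (inj₂ (_ , e)) = ⊥-elim (x≉0 e)

    SetLine-≈ : ∀ {u v m m′} → u ≈L setLine m → v ≈L setLine m′ → m ≈ m′ → u ≈L v
    SetLine-≈ {u} {v} {m} {m′} eu ev m≈m′ =
      ≈L-trans {u} {setLine m} {v} eu (≈L-common (setLine m′) {setLine m} {v} (m≈m′ , Adj-cong m≈m′) ev)

    SetLineThrough-≉ : ∀ {x y u v} (on-u : SetLineThrough x y u) (on-v : SetLineThrough x y v) →
                       ¬ (u ≈L v) → proj₁ on-u ≉ proj₁ on-v
    SetLineThrough-≉ {u = u} {v} (m , eu , _) (m′ , ev , _) u≉v m≈m′ = u≉v (SetLine-≈ {u} {v} eu ev m≈m′)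

    two-through-point⇒root : ∀ {x y u v} (on-u : SetLineThrough x y u) (on-v : SetLineThrough x y v) → ¬ (u ≈L v) →
      g⟨ x ⟩ (proj₁ on-u + proj₁ on-v) ≈ 0# × proj₁ on-u + proj₁ on-v ≉ 0#
    two-through-point⇒root {x} {u = u} {v} on-u@(_ , _ , gm) on-v@(_ , _ , gm′) u≉v =
      additive-root-difference g⟨ x ⟩ (g-+ x) gm gm′ , ≉⇒x+y≉0 (SetLineThrough-≉ {u = u} {v} on-u on-v u≉v)

    rootCondition⇒noThreeConcurrent : RootCondition g⟨_⟩ → NoThreeConcurrent
    rootCondition⇒noThreeConcurrent _ l₁ l₂ l₃ s₁ s₂ s₃ n₁₂ n₁₃ n₂₃ (inf nothing , h₁ , h₂ , h₃) =
      let u , v , u0 , v0 , u≉v = two-of-three _≈L_ (_≈L lv 0#) (_≈L l∞)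
            (λ {u} {v} → ≈L-common l∞ {u} {v}) {l₁} {l₂} {l₃}
            (lineSet∋∞ {l₁} s₁ h₁) (lineSet∋∞ {l₂} s₂ h₂) (lineSet∋∞ {l₃} s₃ h₃) n₁₂ n₁₃ n₂₃
      in u≉v (≈L-common (lv 0#) {u} {v} u0 v0)
    rootCondition⇒noThreeConcurrent _ l₁ l₂ l₃ s₁ s₂ s₃ n₁₂ n₁₃ n₂₃ (inf (just m₀) , h₁ , h₂ , h₃) =
      let u , v , (m , eu , m₀≈m) , (m′ , ev , m₀≈m′) , u≉v = two-of-three _≈L_ (SetLineThrough∞ m₀) (_≈L l∞)
            (λ {u} {v} → ≈L-common l∞ {u} {v}) {l₁} {l₂} {l₃}
            (lineSet∋inf {l₁} s₁ h₁) (lineSet∋inf {l₂} s₂ h₂) (lineSet∋inf {l₃} s₃ h₃) n₁₂ n₁₃ n₂₃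
      in u≉v (SetLine-≈ {u} {v} eu ev (trans (sym m₀≈m) m₀≈m′))
    rootCondition⇒noThreeConcurrent (root₀ , roots) l₁ l₂ l₃ s₁ s₂ s₃ n₁₂ n₁₃ n₂₃ (aff x y , h₁ , h₂ , h₃)
      with x ≟ 0#
    ... | yes x0 =
      let u , v , on-u , on-v , u≉v = two-of-three _≈L_ (SetLineThrough x y) (λ l → l ≈L lv 0# × x ≈ 0#)
            (λ {u} {v} eu ev → ≈L-common (lv 0#) {u} {v} (proj₁ eu) (proj₁ ev)) {l₁} {l₂} {l₃}
            (lineSet∋aff {l₁} s₁ h₁) (lineSet∋aff {l₂} s₂ h₂) (lineSet∋aff {l₃} s₃ h₃) n₁₂ n₁₃ n₂₃
          root , nonzero = two-through-point⇒root {x} {y} {u} {v} on-u on-v u≉v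
      in nonzero (root₀ _ (trans (g-resp-≈ (sym x0) _) root))
    ... | no x≉0 =
      let on₁ = lineSet∋aff-x≉0 {l₁} {x} {y} x≉0 (lineSet∋aff {l₁} s₁ h₁)
          on₂ = lineSet∋aff-x≉0 {l₂} {x} {y} x≉0 (lineSet∋aff {l₂} s₂ h₂)
          on₃ = lineSet∋aff-x≉0 {l₃} {x} {y} x≉0 (lineSet∋aff {l₃} s₃ h₃)
          root₁₂ , nonzero₁₂ = two-through-point⇒root {x} {y} {l₁} {l₂} on₁ on₂ n₁₂
          root₁₃ , nonzero₁₃ = two-through-point⇒root {x} {y} {l₁} {l₃} on₁ on₃ n₁₃
      in roots x x≉0 _ _ root₁₂ root₁₃ nonzero₁₂ nonzero₁₃
           (λ e → SetLineThrough-≉ {x} {y} {l₂} {l₃} on₂ on₃ n₂₃ (+-cancelˡ (proj₁ on₁) _ _ e))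

  module OddDegree (odd : Odd n) where

    Tr-1# : Tr 1# ≈ 1#
    Tr-1# = begin
      Tr 1#                                ≈⟨ sumFin-cong {n} (λ i → pow-1# (2 ℕ.^ toℕ i)) ⟩
      sumFin {n} (λ _ → 1#)                ≈⟨ sumFin-1# n ⟩
      fromℕ n                              ≈⟨ reflexive (≡.cong fromℕ n≡1+2k) ⟩
      1# + fromℕ (k ℕ.+ (k ℕ.+ 0))         ≈⟨ +-congˡ (trans (fromℕ-+ k _) (+-congˡ (trans (fromℕ-+ k 0) (+-identityʳ _)))) ⟩
      1# + (fromℕ k + fromℕ k)             ≈⟨ +-congˡ (x+x≈0 (fromℕ k)) ⟩
      1# + 0#                              ≈⟨ +-identityʳ 1# ⟩
      1#                                   ∎
      where
      k = proj₁ odd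
      n≡1+2k = proj₂ odd

    n∸1+1≡n : n ℕ.∸ 1 ℕ.+ 1 ≡ n
    n∸1+1≡n = ≡.trans (≡.cong (λ m → m ℕ.∸ 1 ℕ.+ 1) (proj₂ odd))
                      (≡.trans (ℕP.+-comm (2 ℕ.* proj₁ odd) 1) (≡.sym (proj₂ odd)))

    Tr-*-pow-2^[n-1] : ∀ x m → Tr (x * pow m (2 ℕ.^ (n ℕ.∸ 1))) ≈ Tr (m * pow x 2)
    Tr-*-pow-2^[n-1] x m = begin
      Tr (x * pow m e)                                    ≈⟨ sym (Tr-square _) ⟩
      Tr (pow (x * pow m e) 2)                            ≈⟨ Tr-cong (pow-distrib-* x _ 2) ⟩
      Tr (pow x 2 * pow (pow m e) (2 ℕ.^ 1))              ≈⟨ Tr-cong (*-congˡ (pow-2^-2^ m (n ℕ.∸ 1) 1)) ⟩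
      Tr (pow x 2 * pow m (2 ℕ.^ (n ℕ.∸ 1 ℕ.+ 1)))        ≈⟨ Tr-cong (*-congˡ (≡⇒pow≈ m (≡.cong (2 ℕ.^_) n∸1+1≡n))) ⟩
      Tr (pow x 2 * pow m q)                              ≈⟨ Tr-cong (*-congˡ (pow-q m)) ⟩
      Tr (pow x 2 * m)                                    ≈⟨ Tr-cong (*-comm _ _) ⟩
      Tr (m * pow x 2)                                    ∎
      where e = 2 ℕ.^ (n ℕ.∸ 1)

    -- (c Tr x + x Tr c)² = c² Tr x + x² Tr c, since the trace takes values in {0, 1}.
    Tr-*-✶ : ∀ c m x → Tr (m * (x ✶ c)) ≈ Tr (x * c * m) + (Tr x * Tr (pow c 2 * m) + Tr c * Tr (m * pow x 2))
    Tr-*-✶ c m x = begin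
      Tr (m * (x * c + pow (c * t + x * s) 2))
        ≈⟨ Tr-cong (*-congˡ (+-congˡ (trans (square-+ _ _) (+-cong square-c-t square-x-s)))) ⟩
      Tr (m * (x * c + (C * t + X * s)))
        ≈⟨ Tr-cong (solve 7 (λ m x c C t X s → (m :* (x :* c :+ (C :* t :+ X :* s))) :=
                                               (x :* c :* m :+ (t :* (C :* m) :+ s :* (m :* X))))
                            refl m x c C t X s) ⟩
      Tr (x * c * m + (t * (C * m) + s * (m * X)))      ≈⟨ trans (Tr-+ _ _) (+-congˡ (Tr-+ _ _)) ⟩
      Tr (x * c * m) + (Tr (t * (C * m)) + Tr (s * (m * X)))
        ≈⟨ +-congˡ (+-cong (Tr-*-bit t _ (Tr≈0⊎Tr≈1 x)) (Tr-*-bit s _ (Tr≈0⊎Tr≈1 c))) ⟩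
      Tr (x * c * m) + (t * Tr (C * m) + s * Tr (m * X)) ∎
      where
      t = Tr x
      s = Tr c
      C = pow c 2
      X = pow x 2
      square-c-t : pow (c * t) 2 ≈ C * t
      square-c-t = trans (pow-distrib-* c t 2) (*-congˡ (square-Tr x))
      square-x-s : pow (x * s) 2 ≈ X * s
      square-x-s = trans (pow-distrib-* x s 2) (*-congˡ (square-Tr c))

    Tr-*-∘ : ∀ c m x → Tr (x * (c ∘ m)) ≈ Tr (x * c * m) + (Tr c * Tr (m * pow x 2) + Tr (pow c 2 * m) * Tr x)
    Tr-*-∘ c m x = begin
      Tr (x * (c * m + s * E + T))
        ≈⟨ Tr-cong (solve 6 (λ x c m s E T → (x :* (c :* m :+ s :* E :+ T)) := (x :* c :* m :+ (s :* (x :* E) :+ T :* x)))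
                            refl x c m s E T) ⟩
      Tr (x * c * m + (s * (x * E) + T * x))             ≈⟨ trans (Tr-+ _ _) (+-congˡ (Tr-+ _ _)) ⟩
      Tr (x * c * m) + (Tr (s * (x * E)) + Tr (T * x))
        ≈⟨ +-congˡ (+-cong (Tr-*-bit s _ (Tr≈0⊎Tr≈1 c)) (Tr-*-bit T x (Tr≈0⊎Tr≈1 _))) ⟩
      Tr (x * c * m) + (s * Tr (x * E) + T * Tr x)       ≈⟨ +-congˡ (+-congʳ (*-congˡ (Tr-*-pow-2^[n-1] x m))) ⟩
      Tr (x * c * m) + (s * Tr (m * pow x 2) + T * Tr x) ∎
      where
      s = Tr c
      E = pow m (2 ℕ.^ (n ℕ.∸ 1))
      T = Tr (pow c 2 * m)

    ✶-∘-adjoint : ∀ c m x → Tr (m * (x ✶ c)) ≈ Tr (x * (c ∘ m))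
    ✶-∘-adjoint c m x =
      trans (Tr-*-✶ c m x) (trans (+-congˡ (trans (+-comm _ _) (+-congˡ (*-comm _ _)))) (sym (Tr-*-∘ c m x)))

    ∣ker∣ : (Carrier → Carrier) → ℕ
    ∣ker∣ h = count {q} (λ i → isZero (h (to i)))

    ∣⊥∣ : Carrier → ℕ
    ∣⊥∣ w = count {q} (λ j → isZero (Tr (to j * w)))

    isZero-+1# : ∀ t → t ≈ 0# ⊎ t ≈ 1# → isZero (t + 1#) ≡ not (isZero t)
    isZero-+1# t (inj₁ t0) rewrite ≈0⇒isZero≡true t0 =
      ≉0⇒isZero≡false (λ e → 0≉1 (sym (trans (sym (trans (+-congʳ t0) (+-identityˡ 1#))) e)))
    isZero-+1# t (inj₂ t1) rewrite ≉0⇒isZero≡false (λ e → 0≉1 (trans (sym e) t1)) =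
      ≈0⇒isZero≡true (trans (+-congʳ t1) 1+1≈0)

    -- For w ≠ 0, translating m by w⁻¹ adds Tr (w⁻¹ w) = 1 to Tr (m w), so exactly half
    -- of F is orthogonal to w.
    2*∣⊥∣ : ∀ w → 2 ℕ.* ∣⊥∣ w ≡ q ℕ.+ indicator (isZero w) ℕ.* q
    2*∣⊥∣ w with w ≟ 0#
    ... | yes w0 = ≡.cong (λ k → k ℕ.+ (k ℕ.+ 0))
                          (≡.trans (count-cong {q} (λ j → ≈0⇒isZero≡true (trans (Tr-cong (trans (*-congˡ w0) (zeroʳ _))) Tr-0#)))
                                   (count-const-true q))
    ... | no w≉0 = ≡.trans (≡.cong (∣⊥∣ w ℕ.+_) (≡.trans (ℕP.+-identityʳ _) half))
                           (≡.trans (count-complement (λ j → P (to j))) (≡.sym (ℕP.+-identityʳ q)))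
      where
      P : Carrier → Bool
      P m = isZero (Tr (m * w))
      v = inv w w≉0
      flip : ∀ m → P (m + v) ≡ not (P m)
      flip m = ≡.trans (isZero-cong (trans (Tr-cong (distribʳ w m v))
                                           (trans (Tr-+ _ _) (+-congˡ (trans (Tr-cong (trans (*-comm _ _) (*-inv w w≉0))) Tr-1#)))))
                       (isZero-+1# _ (Tr≈0⊎Tr≈1 (m * w)))
      involutive : ∀ m → (m + v) + v ≈ m
      involutive m = trans (+-assoc _ _ _) (trans (+-congˡ (x+x≈0 v)) (+-identityʳ m))
      half : count {q} (λ j → P (to j)) ≡ count (λ j → not (P (to j)))
      half = ≡.trans (Reindex.count-reindex (_+ v) (_+ v) +-congʳ +-congʳ involutive involutive
                       P (λ e → isZero-cong (Tr-cong (*-congʳ e))))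
                     (count-cong {q} (λ j → flip (to j)))

    2*Σ∣⊥∣ : ∀ h → 2 ℕ.* Σℕ.sum {q} (λ i → ∣⊥∣ (h (to i))) ≡ q ℕ.* q ℕ.+ ∣ker∣ h ℕ.* q
    2*Σ∣⊥∣ h =
      ≡.trans (ΣS.*-distribˡ-sum 2 (λ i → ∣⊥∣ (h (to i))))
      (≡.trans (Σℕ.sum-cong-≋ {q} (λ i → 2*∣⊥∣ (h (to i))))
      (≡.trans (Σℕ.∑-distrib-+ (λ _ → q) (λ i → indicator (isZero (h (to i))) ℕ.* q))
               (≡.cong₂ ℕ._+_ (sum-const q q) (≡.sym (ΣS.*-distribʳ-sum q (λ i → indicator (isZero (h (to i)))))))))
      where module ΣS = SemiringSum ℕP.+-*-semiring

    -- Count the pairs (x, m) with Tr (m f(x)) = 0 in both orders.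
    adjoint⇒∣ker∣≡ : (f g : Carrier → Carrier) → (∀ x m → Tr (m * f x) ≈ Tr (x * g m)) → ∣ker∣ f ≡ ∣ker∣ g
    adjoint⇒∣ker∣≡ f g adjoint = ℕP.*-cancelʳ-≡ (∣ker∣ f) (∣ker∣ g) q {{q≢0}}
      (ℕP.+-cancelˡ-≡ (q ℕ.* q) _ _ (≡.trans (≡.sym (2*Σ∣⊥∣ f)) (≡.trans (≡.cong (2 ℕ.*_) swap) (2*Σ∣⊥∣ g))))
      where
      q≢0 : ℕ.NonZero q
      q≢0 = ≡.subst ℕ.NonZero (≡.sym (proj₂ q≡suc)) _
      swap : Σℕ.sum {q} (λ i → ∣⊥∣ (f (to i))) ≡ Σℕ.sum {q} (λ j → ∣⊥∣ (g (to j)))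
      swap = ≡.trans (Σℕ.∑-comm (λ i j → indicator (isZero (Tr (to j * f (to i))))))
                     (Σℕ.sum-cong-≋ {q} (λ j → Σℕ.sum-cong-≋ {q} (λ i → ≡.cong indicator (isZero-cong (adjoint (to i) (to j))))))

    module _ {g : Carrier → Carrier} (g-cong : ∀ {x y} → x ≈ y → g x ≈ g y) (g-0# : g 0# ≈ 0#) where

      private
        root-index : ∀ {x} → g x ≈ 0# → isZero (g (to (from x))) ≡ true
        root-index {x} gx = ≈0⇒isZero≡true (trans (g-cong (to-from x)) gx)

        index-≢ : ∀ {x y} → x ≉ y → from y ≢ from x
        index-≢ x≉y e = x≉y (from-injective (≡.sym e))

        to-≉ : ∀ {i j} → j ≢ i → to i ≉ to j
        to-≉ j≢i e = j≢i (≡.sym (to-injective e))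

      ∣ker∣≡⇒NoNonzeroRoot : ∀ {f} → ∣ker∣ f ≡ ∣ker∣ g → NoNonzeroRoot f → NoNonzeroRoot g
      ∣ker∣≡⇒NoNonzeroRoot {f} eq root₀ x gx with x ≟ 0#
      ... | yes x0  = x0
      ... | no x≉0 with 2≤count⇒two-distinct _ (≡.subst (2 ℕ.≤_) (≡.sym eq)
                       (two-distinct⇒2≤count _ (from 0#) (from x) (root-index g-0#) (root-index gx) (index-≢ (λ e → x≉0 (sym e)))))
      ...   | i , j , fi , fj , j≢i = ⊥-elim (to-≉ j≢i (trans (root₀ _ (isZero≡true⇒≈0 fi)) (sym (root₀ _ (isZero≡true⇒≈0 fj)))))

      ∣ker∣≡⇒AtMostOneNonzeroRoot : ∀ {f} → ∣ker∣ f ≡ ∣ker∣ g → AtMostOneNonzeroRoot f → AtMostOneNonzeroRoot g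
      ∣ker∣≡⇒AtMostOneNonzeroRoot {f} eq roots x y gx gy x≉0 y≉0 x≉y
        with 3≤count⇒three-distinct _ (≡.subst (3 ℕ.≤_) (≡.sym eq)
               (three-distinct⇒3≤count _ (from 0#) (from x) (from y) (root-index g-0#) (root-index gx) (root-index gy)
                 (index-≢ (λ e → x≉0 (sym e))) (index-≢ (λ e → y≉0 (sym e))) (index-≢ x≉y)))
      ... | i , j , k , fi , fj , fk , j≢i , k≢i , k≢j with to i ≟ 0# | to j ≟ 0#
      ...   | yes i0  | _      = roots (to j) (to k) (isZero≡true⇒≈0 fj) (isZero≡true⇒≈0 fk) (λ j0 → to-≉ j≢i (trans i0 (sym j0)))
                                   (λ k0 → to-≉ k≢i (trans i0 (sym k0))) (to-≉ k≢j)
      ...   | no i≉0 | yes j0 = roots (to i) (to k) (isZero≡true⇒≈0 fi) (isZero≡true⇒≈0 fk) i≉0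
                                   (λ k0 → to-≉ k≢j (trans j0 (sym k0))) (to-≉ k≢i)
      ...   | no i≉0 | no j≉0 = roots (to i) (to j) (isZero≡true⇒≈0 fi) (isZero≡true⇒≈0 fj) i≉0 j≉0 (to-≉ j≢i)

    rootCondition-transfer : (h k : Carrier → Carrier → Carrier) → (∀ c {x y} → x ≈ y → k c x ≈ k c y) →
      (∀ c → k c 0# ≈ 0#) → (∀ c → ∣ker∣ (h c) ≡ ∣ker∣ (k c)) → RootCondition h → RootCondition k
    rootCondition-transfer h k k-cong k-0# eq (root₀ , roots) =
      ∣ker∣≡⇒NoNonzeroRoot (k-cong 0#) (k-0# 0#) (eq 0#) root₀ ,
      λ c c≉0 → ∣ker∣≡⇒AtMostOneNonzeroRoot (k-cong c) (k-0# c) (eq c) (roots c c≉0)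

    module _ (a : Fin n → Carrier) where
      open Linearized a

      f-g-adjoint : ∀ c x m → Tr (m * f⟨ c ⟩ x) ≈ Tr (x * g⟨ c ⟩ m)
      f-g-adjoint c x m = begin
        Tr (m * ((x ✶ c) + Lin a x))            ≈⟨ trans (Tr-cong (distribˡ _ _ _)) (Tr-+ _ _) ⟩
        Tr (m * (x ✶ c)) + Tr (m * Lin a x)     ≈⟨ +-cong (✶-∘-adjoint c m x) (Tr-*-Lin m x) ⟩
        Tr (x * (c ∘ m)) + Tr (x * Adj a m)     ≈⟨ sym (trans (Tr-cong (distribˡ _ _ _)) (Tr-+ _ _)) ⟩
        Tr (x * ((c ∘ m) + Adj a m))            ∎

      rootCondition-f⇔g : RootCondition f⟨_⟩ ⇔ RootCondition g⟨_⟩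
      rootCondition-f⇔g = mk⇔
        (rootCondition-transfer f⟨_⟩ g⟨_⟩ g-cong g-0# ∣ker-f∣≡∣ker-g∣)
        (rootCondition-transfer g⟨_⟩ f⟨_⟩ f-cong f-0# (λ c → ≡.sym (∣ker-f∣≡∣ker-g∣ c)))
        where
        ∣ker-f∣≡∣ker-g∣ : ∀ c → ∣ker∣ f⟨ c ⟩ ≡ ∣ker∣ g⟨ c ⟩
        ∣ker-f∣≡∣ker-g∣ c = adjoint⇒∣ker∣≡ f⟨ c ⟩ g⟨ c ⟩ (f-g-adjoint c)

theorem3p1 : ∀ {c ℓ} (n : ℕ) → Odd n → (F : CommutativeRing c ℓ) → IsGF F n →
    (a : Fin n → CommutativeRing.Carrier F) →
    GF.Plane.Hyperoval F n (GF._✶_ F n) (GF.GraphSet F n a)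
      ⇔ GF.Plane.LineHyperoval F n (GF._∘_ F n) (GF.LineSet F n a)
theorem3p1 n odd F gf a = mk⇔
  (λ { (_ , noThreeCollinear) → lineSet-hasExactly ,
         rootCondition⇒noThreeConcurrent (Equivalence.to (rootCondition-f⇔g a) (noThreeCollinear⇒rootCondition noThreeCollinear)) })
  (λ { (_ , noThreeConcurrent) → graph-hasExactly ,
         rootCondition⇒noThreeCollinear (Equivalence.from (rootCondition-f⇔g a) (noThreeConcurrent⇒rootCondition noThreeConcurrent)) })
  where
  open FiniteField F n gf
  open Linearized a
  open OddDegree odd
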